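{- Let $n \geq 3$ and let $(\lambda(1),\dots,\lambda(n))$ be a random sequence of partitions generated by Kerov's growth process. Let $X_n = c(x)$, where $x$ is the box added to $\lambda(n-1)$ to obtain $\lambda(n)$, and let \[ T_{n-1} = \frac{\sqrt{\binom{n-1}{2}}\,\chi^{\lambda(n-1)}((12))}{\dim(\lambda(n-1))}. \] Then \begin{enumerate} \item $\mathbb{E}(|X_n|^3) \leq (n-1)\sqrt{2n-3}$; \item $\mathbb{E}(|T_{n-1}|\,|X_n|^3) \leq (n-1)\sqrt{2n-3}$. \end{enumerate}
   Context: For a partition $\mu$ of $j$, $\chi^{\mu}$ is the irreducible character of $S_j$ indexed by $\mu$, $\dim(\mu)$ its dimension, and $\chi^{\mu}((12))$ its value on a transposition. Kerov's growth process: $\lambda(1)$ is the unique partition of $1$; given a partition $\lambda(j)$ of $j$, the partition $\lambda(j+1)$ of $j+1$ is chosen with probability $\frac{\dim(\lambda(j+1))}{(j+1)\dim(\lambda(j))}$ if $\lambda(j+1)$ is obtained from $\lambda(j)$ by adding a single box, and with probability $0$ otherwise. (Each $\lambda(j)$ is then distributed according to the Plancherel measure of $S_j$, which chooses $\mu$ with probability $\dim(\mu)^2/j!$.) The content of a box $x$ is $c(x) = (\text{column number of } x) - (\text{row number of } x)$. -}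

module Defs where

open import Data.Nat as ℕ using (ℕ; zero; suc)
open import Data.Nat.Combinatorics using (_C_)
open import Data.Integer as ℤ using (ℤ; +_)
open import Data.Rational as ℚ using (ℚ; 0ℚ; 1ℚ; _/_)
open import Data.List using (List; []; _∷_; length; map; concatMap; foldr)
open import Data.List.Properties using (≡-dec)
open import Data.Product using (_×_)
open import Data.Sum using (_⊎_)
open import Relation.Binary.PropositionalEquality using (_≡_)
open import Relation.Nullary using (yes; no)

-- Partitions (Young diagrams) as lists of row lengths, longest row first.
-- Rows and columns are indexed from 0 here; contents are unaffected
-- (column - row is invariant under the shift).

Shape : Set
Shape = List ℕ

size : Shape → ℕ
size = foldr ℕ._+_ 0

rowLen : ℕ → Shape → ℕ
rowLen i       []       = 0
rowLen zero    (l ∷ ls) = l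
rowLen (suc i) (l ∷ ls) = rowLen i ls

addBox : ℕ → Shape → Shape
addBox i       []       = 1 ∷ []
addBox zero    (l ∷ ls) = suc l ∷ ls
addBox (suc i) (l ∷ ls) = l ∷ addBox i ls

-- rows where a box can be added keeping a partition:
-- row 0 always; row i+1 iff rowLen i > rowLen (i+1) (includes a new row)
addableFrom : ℕ → ℕ → Shape → List ℕ
addableFrom i prev []       with 0 ℕ.<? prev
... | yes _ = i ∷ []
... | no  _ = []
addableFrom i prev (l ∷ ls) with l ℕ.<? prev
... | yes _ = i ∷ addableFrom (suc i) l ls
... | no  _ = addableFrom (suc i) l ls

addable : Shape → List ℕ
addable []       = 0 ∷ []
addable (l ∷ ls) = 0 ∷ addableFrom 1 l ls

-- Growth sequences ∅ = λ(0) ⊂ λ(1) ⊂ … ⊂ λ(n), each step adding one box,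
-- encoded by the list of rows of the added boxes, MOST RECENT FIRST.
-- (This encoding is a bijection with such sequences of partitions.)

Path : Set
Path = List ℕ

shape : Path → Shape
shape []      = []
shape (r ∷ p) = addBox r (shape p)

paths : ℕ → List Path
paths zero    = [] ∷ []
paths (suc n) = concatMap (λ p → map (λ r → r ∷ p) (addable (shape p))) (paths n)

count : {A : Set} → (A → ℕ) → List A → ℕ
count f = foldr (λ a s → f a ℕ.+ s) 0

isShape : Shape → Path → ℕ
isShape μ p with ≡-dec ℕ._≟_ (shape p) μ
... | yes _ = 1
... | no  _ = 0

-- dim(μ) = number of standard Young tableaux of shape μ
--        = number of growth sequences from ∅ to μ.
dim : Shape → ℕ
dim μ = count (isShape μ) (paths (size μ))

-- first box added (λ(1)) is the last element of the path; the second box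
-- is the second-to-last.  secondRow p = row of the second box.
secondRowIs : ℕ → Path → ℕ
secondRowIs k []            = 0
secondRowIs k (r ∷ [])      = 0
secondRowIs k (r ∷ s ∷ [])  with r ℕ.≟ k
... | yes _ = 1
... | no  _ = 0
secondRowIs k (r ∷ s ∷ t ∷ p) = secondRowIs k (s ∷ t ∷ p)

-- χ^μ((12)) via the Murnaghan–Nakayama rule for cycle type (2,1^{m-2}):
-- remove a domino (the first two boxes), sign +1 for a horizontal domino
-- (shape (2)), -1 for a vertical one (shape (1,1)), then count the ways
-- to build μ box by box.  I.e. #SYT with 1,2 in the same row minus
-- #SYT with 1,2 in the same column.  (Meaningful for |μ| ≥ 2.)
charTransp : Shape → ℤ
charTransp μ =
  + count (λ p → isShape μ p ℕ.* secondRowIs 0 p) (paths (size μ))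
  ℤ.- + count (λ p → isShape μ p ℕ.* secondRowIs 1 p) (paths (size μ))

-- a / b in ℚ, with the (never used) convention a / 0 = 0.
infixl 7 _/'_
_/'_ : ℤ → ℕ → ℚ
a /' zero  = 0ℚ
a /' suc b = a / suc b

fromℕ : ℕ → ℚ
fromℕ n = + n / 1

fromℤ : ℤ → ℚ
fromℤ z = z / 1

sumℚ : {A : Set} → (A → ℚ) → List A → ℚ
sumℚ f = foldr (λ a s → f a ℚ.+ s) 0ℚ

trans : ℕ → Shape → Shape → ℚ
trans j μ μ' = (+ dim μ') /' (suc j ℕ.* dim μ)

prob : Path → ℚ
prob []          = 1ℚ
prob (r ∷ [])    = 1ℚ
prob (r ∷ q@(_ ∷ _)) = trans (length q) (shape q) (shape (r ∷ q)) ℚ.* prob q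

E : ℕ → (Path → ℚ) → ℚ
E n f = sumℚ (λ p → prob p ℚ.* f p) (paths n)

prevShape : Path → Shape
prevShape []      = []
prevShape (r ∷ p) = shape p

-- X_n = content (column - row) of the box added to λ(n-1) to get λ(n)
X : Path → ℤ
X []      = + 0
X (r ∷ p) = + rowLen r (shape p) ℤ.- + r

absℚ : ℚ → ℚ
absℚ = ℚ.∣_∣

cube : ℚ → ℚ
cube x = x ℚ.* x ℚ.* x

-- χ^{λ(n-1)}((12)) / dim(λ(n-1)), i.e. T_{n-1} / √(binom(n-1,2))
normChar : Path → ℚ
normChar p = charTransp (prevShape p) /' dim (prevShape p)

-- Comparison of numbers a·√b and c·√d (b, d ≥ 0) using only ℚ:
-- a·√b ≤ c·√d holds iff one of the following cases occurs.
LeSqrt : ℚ → ℚ → ℚ → ℚ → Set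
LeSqrt a b c d =
    (a ℚ.≤ 0ℚ × 0ℚ ℚ.≤ c)
  ⊎ (0ℚ ℚ.≤ a × 0ℚ ℚ.≤ c × a ℚ.* a ℚ.* b ℚ.≤ c ℚ.* c ℚ.* d)
  ⊎ (a ℚ.≤ 0ℚ × c ℚ.≤ 0ℚ × c ℚ.* c ℚ.* d ℚ.≤ a ℚ.* a ℚ.* b)
  ⊎ (a ℚ.* a ℚ.* b ≡ 0ℚ × c ℚ.* c ℚ.* d ≡ 0ℚ)

choose2 : ℕ → ℕ
choose2 m = m C 2

-- The process chooses a growth sequence of length n with probability dim λ(n) / n!,
-- so every expectation is a sum over growth sequences weighted by dim. For a
-- partition ν and f : ℤ → ℤ put M_f(ν) = ∑ f(c(x)) dim(ν + x) over the addable
-- cells x. The relation DU − UD = 1 of Young's lattice, weighted by contents, gives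
--   M_f(ν) = dim ν · (∑_{x addable} f(c(x)) − ∑_{x removable} f(c(x))) + ∑_{w removable} M_f(ν − w),
-- and the bracket telescopes row by row to 1, 2|ν| and 12 ∑_{cells} c² + 2|ν| for
-- f = 1, c², c⁴. Inducting on |ν| and summing over ν gives E(X_n²) = n − 1 and
-- E(X_n⁴) = (n − 1)(2n − 3); with ∑_μ χ^μ((12))² = 2 (n − 3)! it also gives
-- E(T_{n−1}² X_n²) = n − 1. Both bounds then follow from Cauchy–Schwarz,
-- E(U X²)² ≤ E(U²) E(X⁴) for U = |X_n| and U = |T_{n−1} X_n|, in squared form.
module Submission where

open import Level using (0ℓ)
open import Algebra.Bundles.Raw using (RawRing)
open import Algebra.Bundles using (CommutativeRing)
open import Algebra.Structures using (IsCommutativeRing)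
import Algebra.Properties.CommutativeSemigroup as CommutativeSemigroupProperties
open import Data.Nat as ℕ using (ℕ; zero; suc; _!; z≤n; s≤s)
open import Data.Nat.Combinatorics using (_C_; nC1≡n; nCk+nC[k+1]≡[n+1]C[k+1])
import Data.Nat.Properties as ℕP
open import Data.List using (List; []; _∷_; length; map; concatMap; upTo; applyUpTo; _++_; _∷ʳ_)
import Data.List.Properties as ListP
open import Data.List.Relation.Unary.All as All using (All; []; _∷_)
import Data.List.Relation.Unary.All.Properties as AllP
open import Data.Product using (_×_; _,_; proj₁; proj₂; ∃-syntax)
open import Data.Empty using (⊥-elim)
open import Function using (_∘_; _⇔_; mk⇔; Equivalence)
open import Relation.Binary.PropositionalEquality
open import Relation.Nullary using (Dec; yes; no; ¬_)
open import Data.Integer.Tactic.RingSolver using (solve-∀)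
open import Tactic.RingSolver using () renaming (solve-∀ to solveℚ-∀)
import Tactic.RingSolver.Core.AlmostCommutativeRing as ACR
open import Data.Maybe using (Maybe; just; nothing)
open import Data.Rational.Unnormalised as ℚᵘ using (mkℚᵘ; *≡*; *≤*)
import Data.Rational.Unnormalised.Properties as ℚᵘP
open import Relation.Nullary.Decidable using (_×-dec_)
open import Data.Integer as ℤ using (ℤ; +_)
import Data.Integer.Properties as ℤP
open import Data.Rational as ℚ using (ℚ; 0ℚ; 1ℚ)
import Data.Rational.Properties as ℚP
open import Data.Unit using (⊤; tt)
open import Data.Sum using (_⊎_; inj₁; inj₂)
open import Defs renaming (trans to transition)

module FiniteSums (R : RawRing 0ℓ 0ℓ)
  (isCR : IsCommutativeRing _≡_ (RawRing._+_ R) (RawRing._*_ R) (RawRing.-_ R) (RawRing.0# R) (RawRing.1# R)) where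

  open RawRing R using (_+_; _*_; 0#; 1#) renaming (Carrier to A)

  open IsCommutativeRing isCR
    using (+-assoc; +-identityˡ; +-identityʳ; *-comm; *-identityˡ; distribˡ; zeroˡ; zeroʳ)
  open ≡-Reasoning

  ∑ : {B : Set} → List B → (B → A) → A
  ∑ []       f = 0#
  ∑ (x ∷ xs) f = f x + ∑ xs f

  syntax ∑ xs (λ x → e) = ∑[ x ∈ xs ] e

  ∑< : ℕ → (ℕ → A) → A
  ∑< n = ∑ (upTo n)

  syntax ∑< n (λ i → e) = ∑[ i < n ] e

  𝟙 : {P : Set} → Dec P → A
  𝟙 (yes _) = 1#
  𝟙 (no _)  = 0#

  ∑<∣ : ℕ → {P : ℕ → Set} → (∀ i → Dec (P i)) → (ℕ → A) → A
  ∑<∣ n P? h = ∑[ i < n ] (𝟙 (P? i) * h i)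

  private
    commutativeRing : CommutativeRing 0ℓ 0ℓ
    commutativeRing = record { isCommutativeRing = isCR }

  open CommutativeRing commutativeRing using (+-commutativeSemigroup; *-commutativeSemigroup)
  open CommutativeSemigroupProperties +-commutativeSemigroup using () renaming (interchange to +-interchange)
  open CommutativeSemigroupProperties *-commutativeSemigroup using () renaming (x∙yz≈y∙xz to *-exchange)

  private variable
    B C : Set

  ∑-cong : (xs : List B) {f g : B → A} → (∀ x → f x ≡ g x) → ∑ xs f ≡ ∑ xs g
  ∑-cong []       h = refl
  ∑-cong (x ∷ xs) h = cong₂ _+_ (h x) (∑-cong xs h)

  ∑-congᴬ : {P : B → Set} {xs : List B} {f g : B → A} →
            All P xs → (∀ x → P x → f x ≡ g x) → ∑ xs f ≡ ∑ xs g
  ∑-congᴬ []                  h = refl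
  ∑-congᴬ {xs = x ∷ _} (p ∷ ps) h = cong₂ _+_ (h x p) (∑-congᴬ ps h)

  ∑-0 : (xs : List B) → ∑[ _ ∈ xs ] 0# ≡ 0#
  ∑-0 []       = refl
  ∑-0 (x ∷ xs) = trans (+-identityˡ _) (∑-0 xs)

  ∑-+ : (xs : List B) (f g : B → A) → ∑[ x ∈ xs ] (f x + g x) ≡ ∑ xs f + ∑ xs g
  ∑-+ []       f g = sym (+-identityˡ 0#)
  ∑-+ (x ∷ xs) f g =
    trans (cong (_+_ (f x + g x)) (∑-+ xs f g)) (+-interchange (f x) (g x) (∑ xs f) (∑ xs g))

  ∑-*ˡ : (c : A) (xs : List B) (f : B → A) → ∑[ x ∈ xs ] (c * f x) ≡ c * ∑ xs f
  ∑-*ˡ c []       f = sym (zeroʳ c)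
  ∑-*ˡ c (x ∷ xs) f = trans (cong (_+_ (c * f x)) (∑-*ˡ c xs f)) (sym (distribˡ c (f x) (∑ xs f)))

  ∑-*ʳ : (c : A) (xs : List B) (f : B → A) → ∑[ x ∈ xs ] (f x * c) ≡ ∑ xs f * c
  ∑-*ʳ c xs f = begin
    ∑[ x ∈ xs ] (f x * c) ≡⟨ ∑-cong xs (λ x → *-comm (f x) c) ⟩
    ∑[ x ∈ xs ] (c * f x) ≡⟨ ∑-*ˡ c xs f ⟩
    c * ∑ xs f            ≡⟨ *-comm c (∑ xs f) ⟩
    ∑ xs f * c            ∎

  ∑-++ : (xs ys : List B) (f : B → A) → ∑ (xs ++ ys) f ≡ ∑ xs f + ∑ ys f
  ∑-++ []       ys f = sym (+-identityˡ _)
  ∑-++ (x ∷ xs) ys f = trans (cong (_+_ (f x)) (∑-++ xs ys f)) (sym (+-assoc _ _ _))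

  ∑-map : (g : B → C) (xs : List B) (f : C → A) → ∑ (map g xs) f ≡ ∑[ x ∈ xs ] f (g x)
  ∑-map g []       f = refl
  ∑-map g (x ∷ xs) f = cong (_+_ (f (g x))) (∑-map g xs f)

  ∑-concatMap : (g : B → List C) (xs : List B) (f : C → A) →
                ∑ (concatMap g xs) f ≡ ∑[ x ∈ xs ] ∑ (g x) f
  ∑-concatMap g []       f = refl
  ∑-concatMap g (x ∷ xs) f = trans (∑-++ (g x) (concatMap g xs) f) (cong (_+_ (∑ (g x) f)) (∑-concatMap g xs f))

  ∑-comm : (xs : List B) (ys : List C) (f : B → C → A) →
           ∑[ x ∈ xs ] ∑[ y ∈ ys ] f x y ≡ ∑[ y ∈ ys ] ∑[ x ∈ xs ] f x y
  ∑-comm []       ys f = sym (∑-0 ys)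
  ∑-comm (x ∷ xs) ys f =
    trans (cong (_+_ (∑ ys (f x))) (∑-comm xs ys f)) (sym (∑-+ ys (f x) (λ y → ∑[ x ∈ xs ] f x y)))

  ∑-∑-* : (xs : List B) (ys : List C) (f : B → A) (g : C → A) → ∑[ x ∈ xs ] ∑[ y ∈ ys ] (f x * g y) ≡ ∑ xs f * ∑ ys g
  ∑-∑-* xs ys f g = trans (∑-cong xs (λ x → ∑-*ˡ (f x) ys g)) (∑-*ʳ (∑ ys g) xs f)

  ∑<-suc : ∀ n (f : ℕ → A) → ∑[ i < suc n ] f i ≡ ∑[ i < n ] f i + f n
  ∑<-suc n f = begin
    ∑ (upTo (suc n)) f          ≡⟨ cong (λ is → ∑ is f) (sym (ListP.upTo-∷ʳ n)) ⟩
    ∑ (upTo n ∷ʳ n) f           ≡⟨ ∑-++ (upTo n) (n ∷ []) f ⟩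
    ∑ (upTo n) f + (f n + 0#)   ≡⟨ cong (_+_ (∑ (upTo n) f)) (+-identityʳ (f n)) ⟩
    ∑ (upTo n) f + f n          ∎

  ∑<-shift : ∀ n (f : ℕ → A) → ∑[ i < suc n ] f i ≡ f 0 + ∑[ i < n ] f (suc i)
  ∑<-shift n f = cong (_+_ (f 0)) (begin
    ∑ (applyUpTo suc n) f  ≡⟨ cong (λ is → ∑ is f) (sym (ListP.map-upTo suc n)) ⟩
    ∑ (map suc (upTo n)) f ≡⟨ ∑-map suc (upTo n) f ⟩
    ∑ (upTo n) (f ∘ suc)   ∎)

  ∑<-congᴮ : ∀ n {f g : ℕ → A} → (∀ i → i ℕ.< n → f i ≡ g i) → ∑[ i < n ] f i ≡ ∑[ i < n ] g i
  ∑<-congᴮ zero    h = refl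
  ∑<-congᴮ (suc n) {f} {g} h = begin
    ∑< (suc n) f  ≡⟨ ∑<-suc n f ⟩
    ∑< n f + f n  ≡⟨ cong₂ _+_ (∑<-congᴮ n (λ i i<n → h i (ℕP.m<n⇒m<1+n i<n))) (h n ℕP.≤-refl) ⟩
    ∑< n g + g n  ≡⟨ sym (∑<-suc n g) ⟩
    ∑< (suc n) g  ∎

  ∑<-vanishing : ∀ {m n} (f : ℕ → A) → m ℕ.≤ n → (∀ i → m ℕ.≤ i → f i ≡ 0#) → ∑[ i < n ] f i ≡ ∑[ i < m ] f i
  ∑<-vanishing {m} {n} f m≤n h with ℕP.m≤n⇒∃[o]m+o≡n m≤n
  ... | k , refl = go k
    where
    go : ∀ k → ∑< (m ℕ.+ k) f ≡ ∑< m f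
    go zero    = cong (λ n → ∑< n f) (ℕP.+-identityʳ m)
    go (suc k) = begin
      ∑< (m ℕ.+ suc k) f            ≡⟨ cong (λ n → ∑< n f) (ℕP.+-suc m k) ⟩
      ∑< (suc (m ℕ.+ k)) f          ≡⟨ ∑<-suc (m ℕ.+ k) f ⟩
      ∑< (m ℕ.+ k) f + f (m ℕ.+ k)  ≡⟨ cong₂ _+_ (go k) (h (m ℕ.+ k) (ℕP.m≤m+n m k)) ⟩
      ∑< m f + 0#                   ≡⟨ +-identityʳ _ ⟩
      ∑< m f                        ∎

  𝟙-*-cong : {P : Set} (d : Dec P) {u v : A} → (P → u ≡ v) → 𝟙 d * u ≡ 𝟙 d * v
  𝟙-*-cong (yes p) h = cong (1# *_) (h p)
  𝟙-*-cong (no _)  {u} {v} h = trans (zeroˡ u) (sym (zeroˡ v))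

  𝟙-no : {P : Set} (d : Dec P) → ¬ P → 𝟙 d ≡ 0#
  𝟙-no (yes p) ¬p = ⊥-elim (¬p p)
  𝟙-no (no _)  ¬p = refl

  𝟙-⇔ : {P Q : Set} (d : Dec P) (e : Dec Q) → (P → Q) → (Q → P) → 𝟙 d ≡ 𝟙 e
  𝟙-⇔ (yes p) (yes q) P→Q Q→P = refl
  𝟙-⇔ (yes p) (no ¬q) P→Q Q→P = ⊥-elim (¬q (P→Q p))
  𝟙-⇔ (no ¬p) (yes q) P→Q Q→P = ⊥-elim (¬p (Q→P q))
  𝟙-⇔ (no _)  (no _)  P→Q Q→P = refl

  𝟙-transfer : {P Q : Set} (d : Dec P) (e : Dec Q) {u v : A} →
               (P → Q) → (Q → P) → (P → u ≡ v) → 𝟙 d * u ≡ 𝟙 e * v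
  𝟙-transfer d e {v = v} P→Q Q→P u≡v = trans (𝟙-*-cong d u≡v) (cong (_* v) (𝟙-⇔ d e P→Q Q→P))

  𝟙-*-𝟙 : {P Q : Set} (d : Dec P) (e : Dec Q) (u : A) → 𝟙 d * (𝟙 e * u) ≡ 𝟙 (d ×-dec e) * u
  𝟙-*-𝟙 (yes _) (yes _) u = *-identityˡ (1# * u)
  𝟙-*-𝟙 (yes _) (no _)  u = *-identityˡ (0# * u)
  𝟙-*-𝟙 (no _)  e       u = trans (zeroˡ (𝟙 e * u)) (sym (zeroˡ u))

  𝟙³ : {P Q R : Set} (d : Dec P) (e : Dec Q) (g : Dec R) (u : A) →
       𝟙 d * (𝟙 e * (𝟙 g * u)) ≡ 𝟙 (d ×-dec e ×-dec g) * u
  𝟙³ d e g u = trans (cong (𝟙 d *_) (𝟙-*-𝟙 e g u)) (𝟙-*-𝟙 d (e ×-dec g) u)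

  ∑<-δ : ∀ {n i} (g : ℕ → A) → i ℕ.< n → ∑[ j < n ] (𝟙 (i ℕ.≟ j) * g j) ≡ g i
  ∑<-δ {n} {i} g i<n = begin
    ∑[ j < n ] (𝟙 (i ℕ.≟ j) * g j)                         ≡⟨ ∑<-vanishing _ i<n (λ j i<j → off j (ℕP.<⇒≢ i<j)) ⟩
    ∑[ j < suc i ] (𝟙 (i ℕ.≟ j) * g j)                     ≡⟨ ∑<-suc i _ ⟩
    ∑[ j < i ] (𝟙 (i ℕ.≟ j) * g j) + 𝟙 (i ℕ.≟ i) * g i
      ≡⟨ cong₂ _+_ (trans (∑<-congᴮ i (λ j j<i → off j (ℕP.>⇒≢ j<i))) (∑-0 (upTo i))) (on (i ℕ.≟ i)) ⟩
    0# + g i                                               ≡⟨ +-identityˡ (g i) ⟩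
    g i                                                    ∎
    where
    off : ∀ j → i ≢ j → 𝟙 (i ℕ.≟ j) * g j ≡ 0#
    off j i≢j = trans (cong (_* g j) (𝟙-no (i ℕ.≟ j) i≢j)) (zeroˡ (g j))
    on : (d : Dec (i ≡ i)) → 𝟙 d * g i ≡ g i
    on (yes _)  = *-identityˡ (g i)
    on (no i≢i) = ⊥-elim (i≢i refl)

  module _ {P : ℕ → Set} (P? : ∀ i → Dec (P i)) where

    ∑<∣-cong : ∀ n {h h′ : ℕ → A} → (∀ i → P i → h i ≡ h′ i) → ∑<∣ n P? h ≡ ∑<∣ n P? h′
    ∑<∣-cong n eq = ∑-cong (upTo n) (λ i → 𝟙-*-cong (P? i) (eq i))

    ∑<∣-*ˡ : ∀ n c (h : ℕ → A) → ∑<∣ n P? (λ i → c * h i) ≡ c * ∑<∣ n P? h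
    ∑<∣-*ˡ n c h = trans (∑-cong (upTo n) (λ i → *-exchange (𝟙 (P? i)) c (h i))) (∑-*ˡ c (upTo n) (λ i → 𝟙 (P? i) * h i))

    ∑<∣-*ʳ : ∀ n c (h : ℕ → A) → ∑<∣ n P? (λ i → h i * c) ≡ ∑<∣ n P? h * c
    ∑<∣-*ʳ n c h = begin
      ∑<∣ n P? (λ i → h i * c) ≡⟨ ∑<∣-cong n (λ i _ → *-comm (h i) c) ⟩
      ∑<∣ n P? (λ i → c * h i) ≡⟨ ∑<∣-*ˡ n c h ⟩
      c * ∑<∣ n P? h           ≡⟨ *-comm c _ ⟩
      ∑<∣ n P? h * c           ∎

    ∑<∣-+ : ∀ n (h h′ : ℕ → A) → ∑<∣ n P? (λ i → h i + h′ i) ≡ ∑<∣ n P? h + ∑<∣ n P? h′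
    ∑<∣-+ n h h′ = trans (∑-cong (upTo n) (λ i → distribˡ (𝟙 (P? i)) (h i) (h′ i))) (∑-+ (upTo n) _ _)

    ∑-∑<∣-comm : ∀ n (xs : List B) (g : B → ℕ → A) →
                 ∑[ x ∈ xs ] ∑<∣ n P? (g x) ≡ ∑<∣ n P? (λ i → ∑[ x ∈ xs ] g x i)
    ∑-∑<∣-comm n xs g = trans (∑-comm xs (upTo n) (λ x i → 𝟙 (P? i) * g x i))
                              (∑-cong (upTo n) (λ i → ∑-*ˡ (𝟙 (P? i)) xs (λ x → g x i)))

    ∑<∣-bound : ∀ {m n} (h : ℕ → A) → m ℕ.≤ n → (∀ i → m ℕ.≤ i → ¬ P i) → ∑<∣ n P? h ≡ ∑<∣ m P? h
    ∑<∣-bound h m≤n ¬P = ∑<-vanishing _ m≤n (λ i m≤i → trans (cong (_* h i) (𝟙-no (P? i) (¬P i m≤i))) (zeroˡ (h i)))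

  ∑<∣-comm : ∀ n m {P Q : ℕ → Set} (P? : ∀ i → Dec (P i)) (Q? : ∀ j → Dec (Q j)) (g : ℕ → ℕ → A) →
    ∑<∣ n P? (λ i → ∑<∣ m Q? (g i)) ≡ ∑<∣ m Q? (λ j → ∑<∣ n P? (λ i → g i j))
  ∑<∣-comm n m P? Q? g = begin
    ∑[ i < n ] (𝟙 (P? i) * ∑[ j < m ] (𝟙 (Q? j) * g i j))
      ≡⟨ ∑-cong (upTo n) (λ i → sym (∑-*ˡ (𝟙 (P? i)) (upTo m) (λ j → 𝟙 (Q? j) * g i j))) ⟩
    ∑[ i < n ] ∑[ j < m ] (𝟙 (P? i) * (𝟙 (Q? j) * g i j))
      ≡⟨ ∑-comm (upTo n) (upTo m) (λ i j → 𝟙 (P? i) * (𝟙 (Q? j) * g i j)) ⟩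
    ∑[ j < m ] ∑[ i < n ] (𝟙 (P? i) * (𝟙 (Q? j) * g i j))
      ≡⟨ ∑-cong (upTo m) (λ j → trans (∑-cong (upTo n) (λ i → *-exchange (𝟙 (P? i)) (𝟙 (Q? j)) (g i j)))
                                      (∑-*ˡ (𝟙 (Q? j)) (upTo n) (λ i → 𝟙 (P? i) * g i j))) ⟩
    ∑[ j < m ] (𝟙 (Q? j) * ∑[ i < n ] (𝟙 (P? i) * g i j)) ∎

  ∑∑<∣-comm : ∀ (xs : List B) (ys : List C) n m {P : B → ℕ → Set} {Q : C → ℕ → Set}
    (P? : ∀ x i → Dec (P x i)) (Q? : ∀ y j → Dec (Q y j)) (g : B → ℕ → C → ℕ → A) →
    ∑[ x ∈ xs ] ∑<∣ n (P? x) (λ i → ∑[ y ∈ ys ] ∑<∣ m (Q? y) (g x i y))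
    ≡ ∑[ y ∈ ys ] ∑<∣ m (Q? y) (λ j → ∑[ x ∈ xs ] ∑<∣ n (P? x) (λ i → g x i y j))
  ∑∑<∣-comm xs ys n m P? Q? g = begin
    ∑[ x ∈ xs ] ∑<∣ n (P? x) (λ i → ∑[ y ∈ ys ] ∑<∣ m (Q? y) (g x i y))
      ≡⟨ ∑-cong xs (λ x → sym (∑-∑<∣-comm (P? x) n ys (λ y i → ∑<∣ m (Q? y) (g x i y)))) ⟩
    ∑[ x ∈ xs ] ∑[ y ∈ ys ] ∑<∣ n (P? x) (λ i → ∑<∣ m (Q? y) (g x i y))
      ≡⟨ ∑-comm xs ys _ ⟩
    ∑[ y ∈ ys ] ∑[ x ∈ xs ] ∑<∣ n (P? x) (λ i → ∑<∣ m (Q? y) (g x i y))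
      ≡⟨ ∑-cong ys (λ y → ∑-cong xs (λ x → ∑<∣-comm n m (P? x) (Q? y) (λ i j → g x i y j))) ⟩
    ∑[ y ∈ ys ] ∑[ x ∈ xs ] ∑<∣ m (Q? y) (λ j → ∑<∣ n (P? x) (λ i → g x i y j))
      ≡⟨ ∑-cong ys (λ y → ∑-∑<∣-comm (Q? y) m xs (λ x j → ∑<∣ n (P? x) (λ i → g x i y j))) ⟩
    ∑[ y ∈ ys ] ∑<∣ m (Q? y) (λ j → ∑[ x ∈ xs ] ∑<∣ n (P? x) (λ i → g x i y j)) ∎

-- Young diagrams

IsPartition : Shape → Set
IsPartition []       = ⊤
IsPartition (l ∷ ls) = 1 ℕ.≤ l × rowLen 0 ls ℕ.≤ l × IsPartition ls

Addable : ℕ → Shape → Set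
Addable zero    ν = ⊤
Addable (suc i) ν = rowLen (suc i) ν ℕ.< rowLen i ν

Removable : ℕ → Shape → Set
Removable i ν = rowLen (suc i) ν ℕ.< rowLen i ν

addable? : ∀ i ν → Dec (Addable i ν)
addable? zero    ν = yes tt
addable? (suc i) ν = rowLen (suc i) ν ℕ.<? rowLen i ν

removable? : ∀ i ν → Dec (Removable i ν)
removable? i ν = rowLen (suc i) ν ℕ.<? rowLen i ν

infix 4 _≟ₛ_
_≟ₛ_ : (μ ν : Shape) → Dec (μ ≡ ν)
_≟ₛ_ = ListP.≡-dec ℕ._≟_

-- The content of the cell that addBox i would add to ν; for a removable
-- row i, content i (removeBox i ν) is the content of the removable cell.
content : ℕ → Shape → ℤ
content i ν = + rowLen i ν ℤ.- + i

-- A row emptied by removeBox 0 is dropped when it is the last one.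
consRow : ℕ → Shape → Shape
consRow zero    []       = []
consRow zero    (l ∷ ls) = zero ∷ l ∷ ls
consRow (suc l) ls       = suc l ∷ ls

removeBox : ℕ → Shape → Shape
removeBox i       []       = []
removeBox zero    (l ∷ ls) = consRow (ℕ.pred l) ls
removeBox (suc i) (l ∷ ls) = l ∷ removeBox i ls

rowLen-consRow : ∀ j l ls → rowLen j (consRow l ls) ≡ rowLen j (l ∷ ls)
rowLen-consRow zero    zero    []       = refl
rowLen-consRow (suc j) zero    []       = refl
rowLen-consRow j       zero    (_ ∷ _)  = refl
rowLen-consRow j       (suc l) ls       = refl

rowLen-removeBox-same : ∀ i ν → rowLen i (removeBox i ν) ≡ ℕ.pred (rowLen i ν)
rowLen-removeBox-same i       []       = refl
rowLen-removeBox-same zero    (l ∷ ls) = rowLen-consRow 0 (ℕ.pred l) ls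
rowLen-removeBox-same (suc i) (l ∷ ls) = rowLen-removeBox-same i ls

rowLen-removeBox-other : ∀ i j ν → j ≢ i → rowLen j (removeBox i ν) ≡ rowLen j ν
rowLen-removeBox-other i       j       []       j≢i = refl
rowLen-removeBox-other zero    zero    (l ∷ ls) j≢i = ⊥-elim (j≢i refl)
rowLen-removeBox-other zero    (suc j) (l ∷ ls) j≢i = rowLen-consRow (suc j) (ℕ.pred l) ls
rowLen-removeBox-other (suc i) zero    (l ∷ ls) j≢i = refl
rowLen-removeBox-other (suc i) (suc j) (l ∷ ls) j≢i = rowLen-removeBox-other i j ls (j≢i ∘ cong suc)

rowLen-addBox-same : ∀ i ν → i ℕ.≤ length ν → rowLen i (addBox i ν) ≡ suc (rowLen i ν)
rowLen-addBox-same zero    []       i≤len = refl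
rowLen-addBox-same zero    (l ∷ ls) i≤len = refl
rowLen-addBox-same (suc i) (l ∷ ls) i≤len = rowLen-addBox-same i ls (ℕP.≤-pred i≤len)

rowLen-addBox-other : ∀ i j ν → i ℕ.≤ length ν → j ≢ i → rowLen j (addBox i ν) ≡ rowLen j ν
rowLen-addBox-other zero    zero    ν        i≤len j≢i = ⊥-elim (j≢i refl)
rowLen-addBox-other zero    (suc j) []       i≤len j≢i = refl
rowLen-addBox-other zero    (suc j) (l ∷ ls) i≤len j≢i = refl
rowLen-addBox-other (suc i) zero    (l ∷ ls) i≤len j≢i = refl
rowLen-addBox-other (suc i) (suc j) (l ∷ ls) i≤len j≢i =
  rowLen-addBox-other i j ls (ℕP.≤-pred i≤len) (j≢i ∘ cong suc)

rowLen-beyond : ∀ i ν → length ν ℕ.≤ i → rowLen i ν ≡ 0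
rowLen-beyond i       []       len≤i = refl
rowLen-beyond (suc i) (l ∷ ls) len≤i = rowLen-beyond i ls (ℕP.≤-pred len≤i)

rowLen>0⇒<length : ∀ i ν → 0 ℕ.< rowLen i ν → i ℕ.< length ν
rowLen>0⇒<length i ν 0<row = ℕP.≰⇒> (λ len≤i → ℕP.<-irrefl (sym (rowLen-beyond i ν len≤i)) 0<row)

rowLen-antitone : ∀ {ν} → IsPartition ν → ∀ i → rowLen (suc i) ν ℕ.≤ rowLen i ν
rowLen-antitone {[]}     _           i       = z≤n
rowLen-antitone {l ∷ ls} (_ , q , _) zero    = q
rowLen-antitone {l ∷ ls} (_ , _ , p) (suc i) = rowLen-antitone p i

partition-ext : ∀ {κ ν} → IsPartition κ → IsPartition ν → (∀ j → rowLen j κ ≡ rowLen j ν) → κ ≡ ν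
partition-ext {[]}    {[]}    _           _           h = refl
partition-ext {[]}    {l ∷ ν} _           (1≤l , _)   h = ⊥-elim (ℕP.<-irrefl (h 0) 1≤l)
partition-ext {l ∷ κ} {[]}    (1≤l , _)   _           h = ⊥-elim (ℕP.<-irrefl (sym (h 0)) 1≤l)
partition-ext {l ∷ κ} {k ∷ ν} (_ , _ , p) (_ , _ , q) h = cong₂ _∷_ (h 0) (partition-ext p q (h ∘ suc))

addable⇒≤length : ∀ {ν} i → Addable i ν → i ℕ.≤ length ν
addable⇒≤length {ν} zero    _ = z≤n
addable⇒≤length {ν} (suc i) a = rowLen>0⇒<length i ν (ℕP.≤-<-trans z≤n a)

removable⇒rowLen>0 : ∀ {ν} i → Removable i ν → 0 ℕ.< rowLen i ν
removable⇒rowLen>0 i r = ℕP.≤-<-trans z≤n r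

rowLen-removeBox-≤ : ∀ i j ν → rowLen j (removeBox i ν) ℕ.≤ rowLen j ν
rowLen-removeBox-≤ i j ν with j ℕ.≟ i
... | yes refl = ℕP.≤-trans (ℕP.≤-reflexive (rowLen-removeBox-same i ν)) ℕP.pred[n]≤n
... | no j≢i   = ℕP.≤-reflexive (rowLen-removeBox-other i j ν j≢i)

addBox-isPartition : ∀ {ν} → IsPartition ν → ∀ i → Addable i ν → IsPartition (addBox i ν)
addBox-isPartition {[]}         _           zero          _ = ℕP.≤-refl , z≤n , tt
addBox-isPartition {l ∷ ls}     (p , q , v) zero          _ = s≤s z≤n , ℕP.m≤n⇒m≤1+n q , v
addBox-isPartition {l ∷ []}     (p , q , v) (suc zero)    a = p , a , ℕP.≤-refl , z≤n , tt
addBox-isPartition {l ∷ k ∷ ks} (p , q , v) (suc zero)    a = p , a , addBox-isPartition v zero tt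
addBox-isPartition {l ∷ k ∷ ks} (p , q , v) (suc (suc i)) a = p , q , addBox-isPartition v (suc i) a

removeBox-isPartition : ∀ {ν} → IsPartition ν → ∀ i → Removable i ν → IsPartition (removeBox i ν)
removeBox-isPartition {suc zero ∷ []}     _           zero    r = tt
removeBox-isPartition {suc zero ∷ k ∷ ks} (_ , _ , v) zero    r = ⊥-elim (ℕP.<-irrefl (sym (ℕP.n<1⇒n≡0 r)) (proj₁ v))
removeBox-isPartition {suc (suc l) ∷ ls}  (_ , _ , v) zero    r = s≤s z≤n , ℕP.≤-pred r , v
removeBox-isPartition {l ∷ ls}            (p , q , v) (suc i) r =
  p , ℕP.≤-trans (rowLen-removeBox-≤ i 0 ls) q , removeBox-isPartition v i r

removeBox-addBox : ∀ {τ} → IsPartition τ → ∀ i → Addable i τ → removeBox i (addBox i τ) ≡ τ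
removeBox-addBox {[]}         _           zero          _ = refl
removeBox-addBox {suc l ∷ ls} _           zero          _ = refl
removeBox-addBox {l ∷ []}     _           (suc zero)    _ = refl
removeBox-addBox {l ∷ k ∷ ks} (_ , _ , v) (suc zero)    _ = cong (l ∷_) (removeBox-addBox v zero tt)
removeBox-addBox {l ∷ k ∷ ks} (_ , _ , v) (suc (suc i)) a = cong (l ∷_) (removeBox-addBox v (suc i) a)

addBox-removeBox : ∀ {μ} → IsPartition μ → ∀ i → Removable i μ → addBox i (removeBox i μ) ≡ μ
addBox-removeBox {suc zero ∷ []}     _           zero    r = refl
addBox-removeBox {suc zero ∷ k ∷ ks} (_ , _ , v) zero    r = ⊥-elim (ℕP.<-irrefl (sym (ℕP.n<1⇒n≡0 r)) (proj₁ v))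
addBox-removeBox {suc (suc l) ∷ ls}  _           zero    r = refl
addBox-removeBox {l ∷ ls}            (_ , _ , v) (suc i) r = cong (l ∷_) (addBox-removeBox v i r)

removeBox-addable : ∀ {μ} → IsPartition μ → ∀ i → Removable i μ → Addable i (removeBox i μ)
removeBox-addable          _           zero          r = tt
removeBox-addable {l ∷ ls} (_ , q , _) (suc zero)    r = ℕP.<-≤-trans (begin-strict
  rowLen 0 (removeBox 0 ls) ≡⟨ rowLen-removeBox-same 0 ls ⟩
  ℕ.pred (rowLen 0 ls)      <⟨ ℕP.≤-reflexive (ℕP.suc-pred _ {{ℕ.>-nonZero (removable⇒rowLen>0 {ls} 0 r)}}) ⟩
  rowLen 0 ls               ∎) q
  where open ℕP.≤-Reasoning
removeBox-addable {l ∷ ls} (_ , _ , v) (suc (suc i)) r = removeBox-addable v (suc i) r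

addBox-removable : ∀ {τ} → IsPartition τ → ∀ i → Addable i τ → Removable i (addBox i τ)
addBox-removable {τ} v i a = begin-strict
  rowLen (suc i) (addBox i τ) ≡⟨ rowLen-addBox-other i (suc i) τ i≤len ℕP.1+n≢n ⟩
  rowLen (suc i) τ            ≤⟨ rowLen-antitone v i ⟩
  rowLen i τ                  <⟨ ℕP.n<1+n _ ⟩
  suc (rowLen i τ)            ≡⟨ rowLen-addBox-same i τ i≤len ⟨
  rowLen i (addBox i τ)       ∎
  where
  open ℕP.≤-Reasoning
  i≤len = addable⇒≤length i a

size-addBox : ∀ i ν → i ℕ.≤ length ν → size (addBox i ν) ≡ suc (size ν)
size-addBox zero    []       _     = refl
size-addBox zero    (l ∷ ls) _     = refl
size-addBox (suc i) (l ∷ ls) i≤len =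
  trans (cong (l ℕ.+_) (size-addBox i ls (ℕP.≤-pred i≤len))) (ℕP.+-suc l (size ls))

size-removeBox : ∀ i ν → Removable i ν → suc (size (removeBox i ν)) ≡ size ν
size-removeBox zero    (suc zero ∷ [])     r = refl
size-removeBox zero    (suc zero ∷ k ∷ ks) r = refl
size-removeBox zero    (suc (suc l) ∷ ls)  r = refl
size-removeBox (suc i) (l ∷ ls)            r = trans (sym (ℕP.+-suc l _)) (cong (l ℕ.+_) (size-removeBox i ls r))

length≤size : ∀ {ν} → IsPartition ν → length ν ℕ.≤ size ν
length≤size {[]}     _           = z≤n
length≤size {l ∷ ls} (p , _ , v) = ℕP.+-mono-≤ p (length≤size v)

length<bound : ∀ {ν j B} → IsPartition ν → size ν ≡ j → suc j ℕ.≤ B → suc (length ν) ℕ.≤ B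
length<bound p refl = ℕP.≤-trans (s≤s (length≤size p))

size-removeBox-pred : ∀ {ν j} w → Removable w ν → size ν ≡ suc j → size (removeBox w ν) ≡ j
size-removeBox-pred {ν} w r sν = ℕP.suc-injective (trans (size-removeBox w ν r) sν)

size≡0⇒[] : ∀ {ν} → IsPartition ν → size ν ≡ 0 → ν ≡ []
size≡0⇒[] {[]}         _        _ = refl
size≡0⇒[] {zero ∷ ls}  (() , _) _

¬addable-beyond : ∀ ν i → suc (length ν) ℕ.≤ i → ¬ Addable i ν
¬addable-beyond ν (suc i) len<i a = ℕP.n≮0 (ℕP.<-≤-trans a (ℕP.≤-reflexive (rowLen-beyond i ν (ℕP.≤-pred len<i))))

removeBox≡⇔addBox≡ : ∀ {μ τ} → IsPartition μ → IsPartition τ → ∀ z →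
  (Removable z μ × removeBox z μ ≡ τ) ⇔ (Addable z τ × μ ≡ addBox z τ)
removeBox≡⇔addBox≡ {μ} pμ pτ z = mk⇔
  (λ { (r , refl) → removeBox-addable pμ z r , sym (addBox-removeBox pμ z r) })
  (λ { (a , refl) → addBox-removable pτ z a , removeBox-addBox pτ z a })

addable-below : ∀ {κ ν x} → IsPartition κ → rowLen x ν ℕ.< rowLen x κ →
                (∀ j → suc j ≡ x → rowLen j κ ℕ.≤ rowLen j ν) → Addable x ν
addable-below {x = zero}  _  _     _ = tt
addable-below {κ} {ν} {suc j} pκ ν<κ κ≤ν = begin-strict
  rowLen (suc j) ν <⟨ ν<κ ⟩
  rowLen (suc j) κ ≤⟨ rowLen-antitone pκ j ⟩
  rowLen j κ       ≤⟨ κ≤ν j refl ⟩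
  rowLen j ν       ∎
  where open ℕP.≤-Reasoning

removable-above : ∀ {κ ν y} → IsPartition κ → rowLen y κ ℕ.< rowLen y ν →
                  rowLen (suc y) ν ℕ.≤ rowLen (suc y) κ → Removable y ν
removable-above {κ} {ν} {y} pκ κ<ν ν≤κ = begin-strict
  rowLen (suc y) ν ≤⟨ ν≤κ ⟩
  rowLen (suc y) κ ≤⟨ rowLen-antitone pκ y ⟩
  rowLen y κ       <⟨ κ<ν ⟩
  rowLen y ν       ∎
  where open ℕP.≤-Reasoning

-- κ has one more cell than ν in row x and one fewer in row y, so that
-- κ + y = ν + x and κ − x = ν − y.
Diamond : Shape → ℕ → Shape → ℕ → Set
Diamond κ x ν y = rowLen x κ ≡ suc (rowLen x ν) × rowLen y ν ≡ suc (rowLen y κ)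
                × (∀ j → j ≢ x → j ≢ y → rowLen j κ ≡ rowLen j ν)

module DiamondLemmas {κ ν : Shape} {x y : ℕ} (x≢y : x ≢ y) where

  addBox≡⇒Diamond : Addable x ν → Addable y κ → addBox y κ ≡ addBox x ν → Diamond κ x ν y
  addBox≡⇒Diamond ax ay eq = row-x , row-y , row-other
    where
    x≤len = addable⇒≤length x ax
    y≤len = addable⇒≤length y ay
    row : ∀ j → rowLen j (addBox y κ) ≡ rowLen j (addBox x ν)
    row j = cong (rowLen j) eq
    row-x = trans (sym (rowLen-addBox-other y x κ y≤len x≢y)) (trans (row x) (rowLen-addBox-same x ν x≤len))
    row-y = trans (sym (rowLen-addBox-other x y ν x≤len (x≢y ∘ sym))) (trans (sym (row y)) (rowLen-addBox-same y κ y≤len))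
    row-other : ∀ j → j ≢ x → j ≢ y → rowLen j κ ≡ rowLen j ν
    row-other j j≢x j≢y =
      trans (sym (rowLen-addBox-other y j κ y≤len j≢y)) (trans (row j) (rowLen-addBox-other x j ν x≤len j≢x))

  removeBox≡⇒Diamond : Removable y ν → Removable x κ → removeBox x κ ≡ removeBox y ν → Diamond κ x ν y
  removeBox≡⇒Diamond ry rx eq = row-x , row-y , row-other
    where
    row : ∀ j → rowLen j (removeBox x κ) ≡ rowLen j (removeBox y ν)
    row j = cong (rowLen j) eq
    row-x = trans (sym (ℕP.suc-pred _ {{ℕ.>-nonZero (removable⇒rowLen>0 {κ} x rx)}}))
      (cong suc (trans (sym (rowLen-removeBox-same x κ)) (trans (row x) (rowLen-removeBox-other y x ν x≢y))))
    row-y = trans (sym (ℕP.suc-pred _ {{ℕ.>-nonZero (removable⇒rowLen>0 {ν} y ry)}}))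
      (cong suc (trans (sym (rowLen-removeBox-same y ν)) (trans (sym (row y)) (rowLen-removeBox-other x y κ (x≢y ∘ sym)))))
    row-other : ∀ j → j ≢ x → j ≢ y → rowLen j κ ≡ rowLen j ν
    row-other j j≢x j≢y =
      trans (sym (rowLen-removeBox-other x j κ j≢x)) (trans (row j) (rowLen-removeBox-other y j ν j≢y))

  module _ (pκ : IsPartition κ) (pν : IsPartition ν) (d : Diamond κ x ν y) where

    private
      row-x = proj₁ d
      row-y = proj₁ (proj₂ d)
      row-other = proj₂ (proj₂ d)

      κ≤ν : ∀ j → j ≢ x → rowLen j κ ℕ.≤ rowLen j ν
      κ≤ν j j≢x with j ℕ.≟ y
      ... | yes refl = ℕP.≤-trans (ℕP.n≤1+n _) (ℕP.≤-reflexive (sym row-y))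
      ... | no j≢y   = ℕP.≤-reflexive (row-other j j≢x j≢y)

      ν≤κ : ∀ j → j ≢ y → rowLen j ν ℕ.≤ rowLen j κ
      ν≤κ j j≢y with j ℕ.≟ x
      ... | yes refl = ℕP.≤-trans (ℕP.n≤1+n _) (ℕP.≤-reflexive (sym row-x))
      ... | no j≢x   = ℕP.≤-reflexive (sym (row-other j j≢x j≢y))

      x-row : rowLen x ν ℕ.< rowLen x κ
      x-row = ℕP.≤-reflexive (sym row-x)

      y-row : rowLen y κ ℕ.< rowLen y ν
      y-row = ℕP.≤-reflexive (sym row-y)

    Diamond⇒addable-ν : Addable x ν
    Diamond⇒addable-ν = addable-below pκ x-row (λ j sj≡x → κ≤ν j (λ j≡x → ℕP.1+n≢n (trans sj≡x (sym j≡x))))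

    Diamond⇒addable-κ : Addable y κ
    Diamond⇒addable-κ = addable-below pν y-row (λ j sj≡y → ν≤κ j (λ j≡y → ℕP.1+n≢n (trans sj≡y (sym j≡y))))

    Diamond⇒removable-ν : Removable y ν
    Diamond⇒removable-ν = removable-above {ν = ν} pκ y-row (ν≤κ (suc y) ℕP.1+n≢n)

    Diamond⇒removable-κ : Removable x κ
    Diamond⇒removable-κ = removable-above {ν = κ} pν x-row (κ≤ν (suc x) ℕP.1+n≢n)

    Diamond⇒addBox≡ : addBox y κ ≡ addBox x ν
    Diamond⇒addBox≡ = partition-ext (addBox-isPartition pκ y Diamond⇒addable-κ) (addBox-isPartition pν x Diamond⇒addable-ν) row
      where
      y≤len = addable⇒≤length y Diamond⇒addable-κ
      x≤len = addable⇒≤length x Diamond⇒addable-ν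
      row : ∀ j → rowLen j (addBox y κ) ≡ rowLen j (addBox x ν)
      row j with j ℕ.≟ x | j ℕ.≟ y
      ... | yes refl | yes refl = ⊥-elim (x≢y refl)
      ... | yes refl | no j≢y   =
        trans (rowLen-addBox-other y j κ y≤len j≢y) (trans row-x (sym (rowLen-addBox-same x ν x≤len)))
      ... | no j≢x   | yes refl =
        trans (rowLen-addBox-same y κ y≤len) (trans (sym row-y) (sym (rowLen-addBox-other x j ν x≤len j≢x)))
      ... | no j≢x   | no j≢y   =
        trans (rowLen-addBox-other y j κ y≤len j≢y) (trans (row-other j j≢x j≢y) (sym (rowLen-addBox-other x j ν x≤len j≢x)))

    Diamond⇒removeBox≡ : removeBox x κ ≡ removeBox y ν
    Diamond⇒removeBox≡ =
      partition-ext (removeBox-isPartition pκ x Diamond⇒removable-κ) (removeBox-isPartition pν y Diamond⇒removable-ν) row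
      where
      row : ∀ j → rowLen j (removeBox x κ) ≡ rowLen j (removeBox y ν)
      row j with j ℕ.≟ x | j ℕ.≟ y
      ... | yes refl | yes refl = ⊥-elim (x≢y refl)
      ... | yes refl | no j≢y   =
        trans (rowLen-removeBox-same x κ) (trans (cong ℕ.pred row-x) (sym (rowLen-removeBox-other y j ν j≢y)))
      ... | no j≢x   | yes refl =
        trans (rowLen-removeBox-other x j κ j≢x) (trans (sym (cong ℕ.pred row-y)) (sym (rowLen-removeBox-same y ν)))
      ... | no j≢x   | no j≢y   =
        trans (rowLen-removeBox-other x j κ j≢x) (trans (row-other j j≢x j≢y) (sym (rowLen-removeBox-other y j ν j≢y)))

    Diamond⇒content : content x ν ≡ content x (removeBox x κ)
    Diamond⇒content = cong (λ l → + l ℤ.- + x) (sym (trans (rowLen-removeBox-same x κ) (cong ℕ.pred row-x)))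

module ℤΣ = FiniteSums ℤ.+-*-rawRing ℤP.+-*-isCommutativeRing
module ℚΣ = FiniteSums ℚ.+-*-rawRing ℚP.+-*-isCommutativeRing

module _ where

  open import Data.Integer using (_+_; _*_; _-_; -_)
  open ℤΣ

  -- The commutation relation of Young's lattice

  -- Sums over the corners of ν run over the rows below a bound B, which only
  -- has to exceed the number of rows (∑addable-bound).
  ∑addable : ℕ → Shape → (ℕ → ℤ) → ℤ
  ∑addable B ν = ∑<∣ B (λ i → addable? i ν)

  ∑removable : ℕ → Shape → (ℕ → ℤ) → ℤ
  ∑removable B ν = ∑<∣ B (λ i → removable? i ν)

  ∑addable-bound : ∀ {B B′} ν h → suc (length ν) ℕ.≤ B → B ℕ.≤ B′ → ∑addable B′ ν h ≡ ∑addable B ν h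
  ∑addable-bound ν h len<B B≤B′ =
    ∑<∣-bound (λ i → addable? i ν) h B≤B′ (λ i B≤i → ¬addable-beyond ν i (ℕP.≤-trans len<B B≤i))

  removable-to-addable : ∀ {μ τ} → IsPartition μ → IsPartition τ → ∀ B (h : ℕ → Shape → ℤ) →
    ∑removable B μ (λ z → 𝟙 (removeBox z μ ≟ₛ τ) * h z (removeBox z μ)) ≡ ∑addable B τ (λ z → 𝟙 (μ ≟ₛ addBox z τ) * h z τ)
  removable-to-addable {μ} {τ} pμ pτ B h = ∑-cong (upTo B) pointwise
    where
    open ≡-Reasoning
    pointwise : ∀ z → 𝟙 (removable? z μ) * (𝟙 (removeBox z μ ≟ₛ τ) * h z (removeBox z μ))
                      ≡ 𝟙 (addable? z τ) * (𝟙 (μ ≟ₛ addBox z τ) * h z τ)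
    pointwise z = begin
      𝟙 (removable? z μ) * (𝟙 (removeBox z μ ≟ₛ τ) * h z (removeBox z μ))
        ≡⟨ cong (𝟙 (removable? z μ) *_) (𝟙-*-cong (removeBox z μ ≟ₛ τ) (cong (h z))) ⟩
      𝟙 (removable? z μ) * (𝟙 (removeBox z μ ≟ₛ τ) * h z τ)
        ≡⟨ 𝟙-*-𝟙 (removable? z μ) (removeBox z μ ≟ₛ τ) (h z τ) ⟩
      𝟙 (removable? z μ ×-dec removeBox z μ ≟ₛ τ) * h z τ
        ≡⟨ cong (_* h z τ) (𝟙-⇔ (removable? z μ ×-dec removeBox z μ ≟ₛ τ) (addable? z τ ×-dec μ ≟ₛ addBox z τ) to from) ⟩
      𝟙 (addable? z τ ×-dec μ ≟ₛ addBox z τ) * h z τ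
        ≡⟨ 𝟙-*-𝟙 (addable? z τ) (μ ≟ₛ addBox z τ) (h z τ) ⟨
      𝟙 (addable? z τ) * (𝟙 (μ ≟ₛ addBox z τ) * h z τ) ∎
      where open Equivalence (removeBox≡⇔addBox≡ pμ pτ z)

  cornerTerm : (ℤ → ℤ) → Shape → ℕ → ℤ
  cornerTerm f ν i = 𝟙 (addable? i ν) * f (content i ν) - 𝟙 (removable? i ν) * f (content i (removeBox i ν))

  cornerDiff : ℕ → (ℤ → ℤ) → Shape → ℤ
  cornerDiff B f ν = ∑[ i < B ] cornerTerm f ν i

  module _ {κ ν : Shape} (pκ : IsPartition κ) (pν : IsPartition ν) (f : ℤ → ℤ) where

    private
      Up Down : ℕ → ℕ → Set
      Up x y = Addable x ν × Addable y κ × addBox y κ ≡ addBox x ν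
      Down x y = Removable y ν × Removable x κ × removeBox x κ ≡ removeBox y ν

      up? : ∀ x y → Dec (Up x y)
      up? x y = addable? x ν ×-dec addable? y κ ×-dec addBox y κ ≟ₛ addBox x ν

      down? : ∀ x y → Dec (Down x y)
      down? x y = removable? y ν ×-dec removable? x κ ×-dec removeBox x κ ≟ₛ removeBox y ν

    commutation-off-diagonal : ∀ {x y} → x ≢ y →
      𝟙 (up? x y) * f (content x ν) ≡ 𝟙 (down? x y) * f (content x (removeBox x κ))
    commutation-off-diagonal {x} {y} x≢y = 𝟙-transfer (up? x y) (down? x y) up⇒down down⇒up (cong f ∘ content≡)
      where
      open DiamondLemmas {κ} {ν} x≢y
      up⇒down : Up x y → Down x y
      up⇒down (ax , ay , eq) = let d = addBox≡⇒Diamond ax ay eq in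
        Diamond⇒removable-ν pκ pν d , Diamond⇒removable-κ pκ pν d , Diamond⇒removeBox≡ pκ pν d
      down⇒up : Down x y → Up x y
      down⇒up (ry , rx , eq) = let d = removeBox≡⇒Diamond ry rx eq in
        Diamond⇒addable-ν pκ pν d , Diamond⇒addable-κ pκ pν d , Diamond⇒addBox≡ pκ pν d
      content≡ : Up x y → content x ν ≡ content x (removeBox x κ)
      content≡ (ax , ay , eq) = Diamond⇒content pκ pν (addBox≡⇒Diamond ax ay eq)

    commutation-diagonal : ∀ x →
      𝟙 (up? x x) * f (content x ν) ≡ 𝟙 (κ ≟ₛ ν) * cornerTerm f ν x + 𝟙 (down? x x) * f (content x (removeBox x κ))
    commutation-diagonal x = by-cases (κ ≟ₛ ν)
      where
      open ≡-Reasoning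
      F = f (content x ν)
      G = f (content x (removeBox x κ))
      by-cases : (κ≟ν : Dec (κ ≡ ν)) → 𝟙 (up? x x) * F ≡ 𝟙 κ≟ν * cornerTerm f ν x + 𝟙 (down? x x) * G
      by-cases (no κ≢ν) = begin
        𝟙 (up? x x) * F                    ≡⟨ cong (_* F) (𝟙-no (up? x x) up⇒≡) ⟩
        + 0 * F                            ≡⟨⟩
        + 0 * cornerTerm f ν x + + 0 * G   ≡⟨ cong (λ c → + 0 * cornerTerm f ν x + c * G) (𝟙-no (down? x x) down⇒≡) ⟨
        + 0 * cornerTerm f ν x + 𝟙 (down? x x) * G ∎
        where
        up⇒≡ : ¬ Up x x
        up⇒≡ (ax , ax′ , eq) = κ≢ν (begin
          κ                         ≡⟨ removeBox-addBox pκ x ax′ ⟨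
          removeBox x (addBox x κ)  ≡⟨ cong (removeBox x) eq ⟩
          removeBox x (addBox x ν)  ≡⟨ removeBox-addBox pν x ax ⟩
          ν                         ∎)
        down⇒≡ : ¬ Down x x
        down⇒≡ (rx , rx′ , eq) = κ≢ν (begin
          κ                         ≡⟨ addBox-removeBox pκ x rx′ ⟨
          addBox x (removeBox x κ)  ≡⟨ cong (addBox x) eq ⟩
          addBox x (removeBox x ν)  ≡⟨ addBox-removeBox pν x rx ⟩
          ν                         ∎)
      by-cases (yes refl) = begin
        𝟙 (up? x x) * F                 ≡⟨ cong (_* F) (𝟙-⇔ (up? x x) (addable? x ν) proj₁ (λ a → a , a , refl)) ⟩
        a * F                           ≡⟨ rearrange a F r G ⟩
        + 1 * (a * F - r * G) + r * G   ≡⟨ cong (λ c → + 1 * (a * F - r * G) + c * G)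
                                             (𝟙-⇔ (removable? x ν) (down? x x) (λ r → r , r , refl) proj₁) ⟩
        + 1 * cornerTerm f ν x + 𝟙 (down? x x) * G ∎
        where
        a = 𝟙 (addable? x ν)
        r = 𝟙 (removable? x ν)
        rearrange : ∀ a F r G → a * F ≡ + 1 * (a * F - r * G) + r * G
        rearrange = solve-∀

    commutation-pointwise : ∀ x y →
      𝟙 (up? x y) * f (content x ν)
      ≡ 𝟙 (x ℕ.≟ y) * (𝟙 (κ ≟ₛ ν) * cornerTerm f ν x) + 𝟙 (down? x y) * f (content x (removeBox x κ))
    commutation-pointwise x y = by-cases (x ℕ.≟ y)
      where
      by-cases : (x≟y : Dec (x ≡ y)) →
        𝟙 (up? x y) * f (content x ν)
        ≡ 𝟙 x≟y * (𝟙 (κ ≟ₛ ν) * cornerTerm f ν x) + 𝟙 (down? x y) * f (content x (removeBox x κ))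
      by-cases (yes refl) = trans (commutation-diagonal x)
        (cong (_+ 𝟙 (down? x x) * f (content x (removeBox x κ))) (sym (ℤP.*-identityˡ (𝟙 (κ ≟ₛ ν) * cornerTerm f ν x))))
      by-cases (no x≢y)   = trans (commutation-off-diagonal x≢y) (sym (ℤP.+-identityˡ _))

    addable-commutation : ∀ B →
      ∑addable B ν (λ x → ∑addable B κ (λ y → 𝟙 (addBox y κ ≟ₛ addBox x ν) * f (content x ν)))
      ≡ 𝟙 (κ ≟ₛ ν) * cornerDiff B f ν
        + ∑removable B ν (λ y → ∑removable B κ (λ x → 𝟙 (removeBox x κ ≟ₛ removeBox y ν) * f (content x (removeBox x κ))))
    addable-commutation B = begin
      ∑addable B ν (λ x → ∑addable B κ (λ y → 𝟙 (addBox y κ ≟ₛ addBox x ν) * F x))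
        ≡⟨ ∑-cong (upTo B) (λ x →
             trans (sym (∑-*ˡ (𝟙 (addable? x ν)) (upTo B) (λ y → 𝟙 (addable? y κ) * (𝟙 (addBox y κ ≟ₛ addBox x ν) * F x))))
                   (∑-cong (upTo B) (λ y → 𝟙³ (addable? x ν) (addable? y κ) (addBox y κ ≟ₛ addBox x ν) (F x)))) ⟩
      ∑[ x < B ] ∑[ y < B ] (𝟙 (up? x y) * F x)
        ≡⟨ ∑-cong (upTo B) (λ x → ∑-cong (upTo B) (commutation-pointwise x)) ⟩
      ∑[ x < B ] ∑[ y < B ] (𝟙 (x ℕ.≟ y) * (𝟙 (κ ≟ₛ ν) * cornerTerm f ν x) + 𝟙 (down? x y) * G x)
        ≡⟨ trans (∑-cong (upTo B) (λ x → ∑-+ (upTo B) _ _)) (∑-+ (upTo B) _ _) ⟩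
      ∑[ x < B ] ∑[ y < B ] (𝟙 (x ℕ.≟ y) * (𝟙 (κ ≟ₛ ν) * cornerTerm f ν x)) + ∑[ x < B ] ∑[ y < B ] (𝟙 (down? x y) * G x)
        ≡⟨ cong₂ _+_ diagonal (∑-comm (upTo B) (upTo B) (λ x y → 𝟙 (down? x y) * G x)) ⟩
      𝟙 (κ ≟ₛ ν) * cornerDiff B f ν + ∑[ y < B ] ∑[ x < B ] (𝟙 (down? x y) * G x)
        ≡⟨ cong (_+_ (𝟙 (κ ≟ₛ ν) * cornerDiff B f ν))
             (∑-cong (upTo B) (λ y →
               trans (∑-cong (upTo B) (λ x → sym (𝟙³ (removable? y ν) (removable? x κ) (removeBox x κ ≟ₛ removeBox y ν) (G x))))
                     (∑-*ˡ (𝟙 (removable? y ν)) (upTo B) (λ x → 𝟙 (removable? x κ) * (𝟙 (removeBox x κ ≟ₛ removeBox y ν) * G x))))) ⟩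
      𝟙 (κ ≟ₛ ν) * cornerDiff B f ν
        + ∑removable B ν (λ y → ∑removable B κ (λ x → 𝟙 (removeBox x κ ≟ₛ removeBox y ν) * G x)) ∎
      where
      open ≡-Reasoning
      F G : ℕ → ℤ
      F x = f (content x ν)
      G x = f (content x (removeBox x κ))
      diagonal : ∑[ x < B ] ∑[ y < B ] (𝟙 (x ℕ.≟ y) * (𝟙 (κ ≟ₛ ν) * cornerTerm f ν x)) ≡ 𝟙 (κ ≟ₛ ν) * cornerDiff B f ν
      diagonal = trans (∑<-congᴮ B (λ x x<B → ∑<-δ (λ _ → 𝟙 (κ ≟ₛ ν) * cornerTerm f ν x) x<B))
                       (∑-*ˡ (𝟙 (κ ≟ₛ ν)) (upTo B) (cornerTerm f ν))

  -- Growth sequences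

  ∑-addableFrom : ∀ k prev ls (h : ℕ → ℤ) →
    ∑ (addableFrom k prev ls) h ≡ ∑[ t < suc (length ls) ] (𝟙 (addable? (suc t) (prev ∷ ls)) * h (k ℕ.+ t))
  ∑-addableFrom k prev [] h with 0 ℕ.<? prev
  ... | yes _ = cong (_+ + 0) (trans (cong h (sym (ℕP.+-identityʳ k))) (sym (ℤP.*-identityˡ _)))
  ... | no  _ = refl
  ∑-addableFrom k prev (l ∷ ls) h = begin
    ∑ (addableFrom k prev (l ∷ ls)) h
      ≡⟨ first-row ⟩
    𝟙 (l ℕ.<? prev) * h (k ℕ.+ 0) + ∑[ t < suc (length ls) ] (𝟙 (addable? (suc t) (l ∷ ls)) * h (k ℕ.+ suc t))
      ≡⟨ ∑<-shift (suc (length ls)) (λ t → 𝟙 (addable? (suc t) (prev ∷ l ∷ ls)) * h (k ℕ.+ t)) ⟨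
    ∑[ t < suc (suc (length ls)) ] (𝟙 (addable? (suc t) (prev ∷ l ∷ ls)) * h (k ℕ.+ t)) ∎
    where
    open ≡-Reasoning
    rest : ∑ (addableFrom (suc k) l ls) h
           ≡ ∑[ t < suc (length ls) ] (𝟙 (addable? (suc t) (l ∷ ls)) * h (k ℕ.+ suc t))
    rest = trans (∑-addableFrom (suc k) l ls h)
                 (∑-cong (upTo (suc (length ls))) (λ t → cong (λ i → 𝟙 (addable? (suc t) (l ∷ ls)) * h i) (sym (ℕP.+-suc k t))))
    first-row : ∑ (addableFrom k prev (l ∷ ls)) h
      ≡ 𝟙 (l ℕ.<? prev) * h (k ℕ.+ 0) + ∑[ t < suc (length ls) ] (𝟙 (addable? (suc t) (l ∷ ls)) * h (k ℕ.+ suc t))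
    first-row with l ℕ.<? prev
    ... | yes _ = cong₂ _+_ (trans (cong h (sym (ℕP.+-identityʳ k))) (sym (ℤP.*-identityˡ _))) rest
    ... | no  _ = trans rest (sym (ℤP.+-identityˡ _))

  ∑-addable : ∀ ν (h : ℕ → ℤ) B → suc (length ν) ℕ.≤ B → ∑ (addable ν) h ≡ ∑addable B ν h
  ∑-addable []       h B len<B =
    trans (cong (_+ + 0) (sym (ℤP.*-identityˡ (h 0)))) (sym (∑addable-bound [] h ℕP.≤-refl len<B))
  ∑-addable (l ∷ ls) h B len<B = begin
    h 0 + ∑ (addableFrom 1 l ls) h
      ≡⟨ cong₂ _+_ (sym (ℤP.*-identityˡ (h 0))) (∑-addableFrom 1 l ls h) ⟩
    + 1 * h 0 + ∑[ t < suc (length ls) ] (𝟙 (addable? (suc t) (l ∷ ls)) * h (suc t))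
      ≡⟨ ∑<-shift (suc (length ls)) (λ i → 𝟙 (addable? i (l ∷ ls)) * h i) ⟨
    ∑addable (suc (length (l ∷ ls))) (l ∷ ls) h
      ≡⟨ ∑addable-bound (l ∷ ls) h ℕP.≤-refl len<B ⟨
    ∑addable B (l ∷ ls) h ∎
    where open ≡-Reasoning

  private
    AddableAt : ℕ → ℕ → Shape → ℕ → Set
    AddableAt k prev ls i = ∃[ t ] i ≡ k ℕ.+ t × Addable (suc t) (prev ∷ ls)

    AddableAt-suc : ∀ {k prev l ls i} → AddableAt (suc k) l ls i → AddableAt k prev (l ∷ ls) i
    AddableAt-suc {k} (t , eq , a) = suc t , trans eq (sym (ℕP.+-suc k t)) , a

  addableFrom-addable : ∀ k prev ls → All (AddableAt k prev ls) (addableFrom k prev ls)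
  addableFrom-addable k prev [] with 0 ℕ.<? prev
  ... | yes p = (0 , sym (ℕP.+-identityʳ k) , p) ∷ []
  ... | no _  = []
  addableFrom-addable k prev (l ∷ ls) with l ℕ.<? prev
  ... | yes p = (0 , sym (ℕP.+-identityʳ k) , p) ∷ All.map AddableAt-suc (addableFrom-addable (suc k) l ls)
  ... | no _  = All.map AddableAt-suc (addableFrom-addable (suc k) l ls)

  addable-addable : ∀ ν → All (λ i → Addable i ν) (addable ν)
  addable-addable []       = tt ∷ []
  addable-addable (l ∷ ls) = tt ∷ All.map (λ { (t , refl , a) → a }) (addableFrom-addable 1 l ls)

  WellFormed : ℕ → Path → Set
  WellFormed j q = IsPartition (shape q) × size (shape q) ≡ j × length q ≡ j

  paths-wellFormed : ∀ j → All (WellFormed j) (paths j)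
  paths-wellFormed zero    = (tt , refl , refl) ∷ []
  paths-wellFormed (suc j) = AllP.concat⁺ (AllP.map⁺ (All.map extend (paths-wellFormed j)))
    where
    extend : ∀ {q} → WellFormed j q → All (WellFormed (suc j)) (map (_∷ q) (addable (shape q)))
    extend {q} (p , s , l) = AllP.map⁺ (All.map step (addable-addable (shape q)))
      where
      step : ∀ {r} → Addable r (shape q) → WellFormed (suc j) (r ∷ q)
      step {r} a = addBox-isPartition p r a , trans (size-addBox r (shape q) (addable⇒≤length r a)) (cong suc s) , cong suc l

  wellFormed⇒length< : ∀ {j q B} → WellFormed j q → suc j ℕ.≤ B → suc (length (shape q)) ℕ.≤ B
  wellFormed⇒length< (p , s , _) = length<bound p s

  ∑paths-suc : ∀ j B (φ : Path → ℤ) → suc j ℕ.≤ B →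
    ∑ (paths (suc j)) φ ≡ ∑[ q ∈ paths j ] ∑addable B (shape q) (λ r → φ (r ∷ q))
  ∑paths-suc j B φ j<B = begin
    ∑ (paths (suc j)) φ                                       ≡⟨ ∑-concatMap _ (paths j) φ ⟩
    ∑[ q ∈ paths j ] ∑ (map (_∷ q) (addable (shape q))) φ     ≡⟨ ∑-cong (paths j) (λ q → ∑-map (_∷ q) (addable (shape q)) φ) ⟩
    ∑[ q ∈ paths j ] ∑[ r ∈ addable (shape q) ] φ (r ∷ q)     ≡⟨ ∑-congᴬ (paths-wellFormed j) (λ q wf →
                                                                   ∑-addable (shape q) (λ r → φ (r ∷ q)) B (wellFormed⇒length< {q = q} wf j<B)) ⟩
    ∑[ q ∈ paths j ] ∑addable B (shape q) (λ r → φ (r ∷ q))  ∎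
    where open ≡-Reasoning

  -- For a = 1 this is dim μ, for a = dominoSign it is χ^μ((12)) (when j = |μ|).
  weightTo : ℕ → (Path → ℤ) → Shape → ℤ
  weightTo j a μ = ∑[ q ∈ paths j ] (𝟙 (shape q ≟ₛ μ) * a q)

  -- For a = 1 and ν ⊢ j this is ∑ₓ f(cₓ) dim(ν + x) = (j + 1) dim ν · E(f(X_{j+1}) | λ(j) = ν).
  transitionSum : ℕ → ℕ → (Path → ℤ) → (ℤ → ℤ) → Shape → ℤ
  transitionSum B j a f ν = ∑addable B ν (λ x → f (content x ν) * weightTo (suc j) a (addBox x ν))

  Extends : ℕ → (Path → ℤ) → (Path → ℤ) → Set
  Extends j a a′ = ∀ r q → length q ≡ j → a′ (r ∷ q) ≡ a q

  weightTo-suc-addable : ∀ {j a a′} B μ → Extends j a a′ → suc j ℕ.≤ B →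
    weightTo (suc j) a′ μ ≡ ∑[ q ∈ paths j ] (a q * ∑addable B (shape q) (λ y → 𝟙 (addBox y (shape q) ≟ₛ μ)))
  weightTo-suc-addable {j} {a} {a′} B μ ext j<B = begin
    weightTo (suc j) a′ μ
      ≡⟨ ∑paths-suc j B (λ p → 𝟙 (shape p ≟ₛ μ) * a′ p) j<B ⟩
    ∑[ q ∈ paths j ] ∑addable B (shape q) (λ y → 𝟙 (addBox y (shape q) ≟ₛ μ) * a′ (y ∷ q))
      ≡⟨ ∑-congᴬ (paths-wellFormed j) (λ q wf → tail-invariant q (proj₂ (proj₂ wf))) ⟩
    ∑[ q ∈ paths j ] (a q * ∑addable B (shape q) (λ y → 𝟙 (addBox y (shape q) ≟ₛ μ))) ∎
    where
    open ≡-Reasoning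
    tail-invariant : ∀ q → length q ≡ j →
      ∑addable B (shape q) (λ y → 𝟙 (addBox y (shape q) ≟ₛ μ) * a′ (y ∷ q))
      ≡ a q * ∑addable B (shape q) (λ y → 𝟙 (addBox y (shape q) ≟ₛ μ))
    tail-invariant q len = trans
      (∑<∣-cong (λ y → addable? y (shape q)) B (λ y _ →
         trans (cong (𝟙 (addBox y (shape q) ≟ₛ μ) *_) (ext y q len)) (ℤP.*-comm (𝟙 (addBox y (shape q) ≟ₛ μ)) (a q))))
      (∑<∣-*ˡ (λ y → addable? y (shape q)) B (a q) (λ y → 𝟙 (addBox y (shape q) ≟ₛ μ)))

  𝟙-≟ₛ-sym : ∀ μ ν → 𝟙 (μ ≟ₛ ν) ≡ 𝟙 (ν ≟ₛ μ)
  𝟙-≟ₛ-sym μ ν = 𝟙-⇔ (μ ≟ₛ ν) (ν ≟ₛ μ) sym sym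

  weightTo-suc : ∀ {j a a′} B {μ} → IsPartition μ → Extends j a a′ → suc j ℕ.≤ B →
    weightTo (suc j) a′ μ ≡ ∑removable B μ (λ z → weightTo j a (removeBox z μ))
  weightTo-suc {j} {a} {a′} B {μ} pμ ext j<B = begin
    weightTo (suc j) a′ μ
      ≡⟨ weightTo-suc-addable B μ ext j<B ⟩
    ∑[ q ∈ paths j ] (a q * ∑addable B (shape q) (λ y → 𝟙 (addBox y (shape q) ≟ₛ μ)))
      ≡⟨ ∑-congᴬ (paths-wellFormed j) (λ q wf → via-removable q (proj₁ wf)) ⟩
    ∑[ q ∈ paths j ] ∑removable B μ (λ z → 𝟙 (removeBox z μ ≟ₛ shape q) * a q)
      ≡⟨ ∑-∑<∣-comm (λ z → removable? z μ) B (paths j) (λ q z → 𝟙 (removeBox z μ ≟ₛ shape q) * a q) ⟩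
    ∑removable B μ (λ z → ∑[ q ∈ paths j ] (𝟙 (removeBox z μ ≟ₛ shape q) * a q))
      ≡⟨ ∑<∣-cong (λ z → removable? z μ) B (λ z _ → ∑-cong (paths j) (λ q → cong (_* a q) (𝟙-≟ₛ-sym (removeBox z μ) (shape q)))) ⟩
    ∑removable B μ (λ z → weightTo j a (removeBox z μ)) ∎
    where
    open ≡-Reasoning
    via-removable : ∀ q → IsPartition (shape q) →
      a q * ∑addable B (shape q) (λ y → 𝟙 (addBox y (shape q) ≟ₛ μ)) ≡ ∑removable B μ (λ z → 𝟙 (removeBox z μ ≟ₛ shape q) * a q)
    via-removable q pκ = begin
      a q * ∑addable B κ (λ y → 𝟙 (addBox y κ ≟ₛ μ))
        ≡⟨ ∑<∣-*ˡ (λ y → addable? y κ) B (a q) (λ y → 𝟙 (addBox y κ ≟ₛ μ)) ⟨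
      ∑addable B κ (λ y → a q * 𝟙 (addBox y κ ≟ₛ μ))
        ≡⟨ ∑<∣-cong (λ y → addable? y κ) B (λ y _ →
             trans (ℤP.*-comm (a q) _) (cong (_* a q) (𝟙-≟ₛ-sym (addBox y κ) μ))) ⟩
      ∑addable B κ (λ y → 𝟙 (μ ≟ₛ addBox y κ) * a q)
        ≡⟨ removable-to-addable pμ pκ B (λ _ _ → a q) ⟨
      ∑removable B μ (λ z → 𝟙 (removeBox z μ ≟ₛ κ) * a q) ∎
      where κ = shape q

  transfer : ∀ {τ} → IsPartition τ → ∀ j B (a : Path → ℤ) (f : ℤ → ℤ) →
    ∑[ q ∈ paths (suc j) ] (a q * ∑removable B (shape q) (λ z → 𝟙 (removeBox z (shape q) ≟ₛ τ) * f (content z (removeBox z (shape q)))))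
    ≡ transitionSum B j a f τ
  transfer {τ} pτ j B a f = begin
    ∑[ q ∈ paths (suc j) ] (a q * ∑removable B (shape q) (λ z → 𝟙 (removeBox z (shape q) ≟ₛ τ) * f (content z (removeBox z (shape q)))))
      ≡⟨ ∑-congᴬ (paths-wellFormed (suc j)) (λ q wf → cong (a q *_) (removable-to-addable (proj₁ wf) pτ B (λ z σ → f (content z σ)))) ⟩
    ∑[ q ∈ paths (suc j) ] (a q * ∑addable B τ (λ z → 𝟙 (shape q ≟ₛ addBox z τ) * f (content z τ)))
      ≡⟨ ∑-cong (paths (suc j)) (λ q →
           trans (sym (∑<∣-*ˡ (λ z → addable? z τ) B (a q) (λ z → 𝟙 (shape q ≟ₛ addBox z τ) * f (content z τ))))
                 (∑<∣-cong (λ z → addable? z τ) B (λ z _ → rearrange (a q) (𝟙 (shape q ≟ₛ addBox z τ)) (f (content z τ))))) ⟩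
    ∑[ q ∈ paths (suc j) ] ∑addable B τ (λ z → f (content z τ) * (𝟙 (shape q ≟ₛ addBox z τ) * a q))
      ≡⟨ ∑-∑<∣-comm (λ z → addable? z τ) B (paths (suc j)) (λ q z → f (content z τ) * (𝟙 (shape q ≟ₛ addBox z τ) * a q)) ⟩
    ∑addable B τ (λ z → ∑[ q ∈ paths (suc j) ] (f (content z τ) * (𝟙 (shape q ≟ₛ addBox z τ) * a q)))
      ≡⟨ ∑<∣-cong (λ z → addable? z τ) B (λ z _ → ∑-*ˡ (f (content z τ)) (paths (suc j)) (λ q → 𝟙 (shape q ≟ₛ addBox z τ) * a q)) ⟩
    transitionSum B j a f τ ∎
    where
    open ≡-Reasoning
    rearrange : ∀ a e F → a * (e * F) ≡ F * (e * a)
    rearrange = solve-∀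

  transitionSum-via-paths : ∀ {j a a′} B f ν → Extends (suc j) a a′ → suc (suc j) ℕ.≤ B →
    transitionSum B (suc j) a′ f ν
    ≡ ∑[ q ∈ paths (suc j) ] (a q * ∑addable B ν (λ x → ∑addable B (shape q) (λ y →
        𝟙 (addBox y (shape q) ≟ₛ addBox x ν) * f (content x ν))))
  transitionSum-via-paths {j} {a} {a′} B f ν ext j<B = begin
    transitionSum B (suc j) a′ f ν
      ≡⟨ ∑<∣-cong (λ x → addable? x ν) B (λ x _ → cong (F x *_) (weightTo-suc-addable B (addBox x ν) ext j<B)) ⟩
    ∑addable B ν (λ x → F x * ∑[ q ∈ P ] (a q * K q x))
      ≡⟨ ∑<∣-cong (λ x → addable? x ν) B (λ x _ → trans (sym (∑-*ˡ (F x) P (λ q → a q * K q x)))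
                                                       (∑-cong P (λ q → pull-weight q x))) ⟩
    ∑addable B ν (λ x → ∑[ q ∈ P ] (a q * Up q x))
      ≡⟨ ∑-∑<∣-comm (λ x → addable? x ν) B P (λ q x → a q * Up q x) ⟨
    ∑[ q ∈ P ] ∑addable B ν (λ x → a q * Up q x)
      ≡⟨ ∑-cong P (λ q → ∑<∣-*ˡ (λ x → addable? x ν) B (a q) (Up q)) ⟩
    ∑[ q ∈ P ] (a q * ∑addable B ν (Up q)) ∎
    where
    open ≡-Reasoning
    P = paths (suc j)
    F : ℕ → ℤ
    F x = f (content x ν)
    K Up : Path → ℕ → ℤ
    K q x = ∑addable B (shape q) (λ y → 𝟙 (addBox y (shape q) ≟ₛ addBox x ν))
    Up q x = ∑addable B (shape q) (λ y → 𝟙 (addBox y (shape q) ≟ₛ addBox x ν) * F x)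
    pull-weight : ∀ q x → F x * (a q * K q x) ≡ a q * Up q x
    pull-weight q x = begin
      F x * (a q * K q x) ≡⟨ rearrange (F x) (a q) (K q x) ⟩
      a q * (K q x * F x) ≡⟨ cong (a q *_) (∑<∣-*ʳ (λ y → addable? y (shape q)) B (F x) _) ⟨
      a q * Up q x        ∎
      where
      rearrange : ∀ u v w → u * (v * w) ≡ v * (w * u)
      rearrange = solve-∀

  ∑paths-transfer : ∀ {ν} → IsPartition ν → ∀ j B (a : Path → ℤ) (f : ℤ → ℤ) →
    ∑[ q ∈ paths (suc j) ] (a q * ∑removable B ν (λ y → ∑removable B (shape q) (λ x →
      𝟙 (removeBox x (shape q) ≟ₛ removeBox y ν) * f (content x (removeBox x (shape q))))))
    ≡ ∑removable B ν (λ w → transitionSum B j a f (removeBox w ν))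
  ∑paths-transfer {ν} pν j B a f = begin
    ∑[ q ∈ P ] (a q * ∑removable B ν (Down q))
      ≡⟨ ∑-cong P (λ q → sym (∑<∣-*ˡ (λ y → removable? y ν) B (a q) (Down q))) ⟩
    ∑[ q ∈ P ] ∑removable B ν (λ y → a q * Down q y)
      ≡⟨ ∑-∑<∣-comm (λ y → removable? y ν) B P (λ q y → a q * Down q y) ⟩
    ∑removable B ν (λ y → ∑[ q ∈ P ] (a q * Down q y))
      ≡⟨ ∑<∣-cong (λ y → removable? y ν) B (λ y r → transfer (removeBox-isPartition pν y r) j B a f) ⟩
    ∑removable B ν (λ w → transitionSum B j a f (removeBox w ν)) ∎
    where
    open ≡-Reasoning
    P = paths (suc j)
    Down : Path → ℕ → ℤ
    Down q y = ∑removable B (shape q) (λ x → 𝟙 (removeBox x (shape q) ≟ₛ removeBox y ν) * f (content x (removeBox x (shape q))))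

  transitionSum-commutation : ∀ {j a a′} B f {ν} → IsPartition ν → Extends (suc j) a a′ → suc (suc j) ℕ.≤ B →
    transitionSum B (suc j) a′ f ν ≡ weightTo (suc j) a ν * cornerDiff B f ν + ∑removable B ν (λ w → transitionSum B j a f (removeBox w ν))
  transitionSum-commutation {j} {a} {a′} B f {ν} pν ext j<B = begin
    transitionSum B (suc j) a′ f ν
      ≡⟨ transitionSum-via-paths B f ν ext j<B ⟩
    ∑[ q ∈ P ] (a q * ∑addable B ν (λ x → ∑addable B (shape q) (λ y → 𝟙 (addBox y (shape q) ≟ₛ addBox x ν) * f (content x ν))))
      ≡⟨ ∑-congᴬ (paths-wellFormed (suc j)) (λ q wf → cong (a q *_) (addable-commutation (proj₁ wf) pν f B)) ⟩
    ∑[ q ∈ P ] (a q * (𝟙 (shape q ≟ₛ ν) * D + Down q))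
      ≡⟨ trans (∑-cong P (λ q → ℤP.*-distribˡ-+ (a q) (𝟙 (shape q ≟ₛ ν) * D) (Down q)))
               (∑-+ P (λ q → a q * (𝟙 (shape q ≟ₛ ν) * D)) (λ q → a q * Down q)) ⟩
    ∑[ q ∈ P ] (a q * (𝟙 (shape q ≟ₛ ν) * D)) + ∑[ q ∈ P ] (a q * Down q)
      ≡⟨ cong₂ _+_ diagonal (∑paths-transfer pν j B a f) ⟩
    weightTo (suc j) a ν * D + ∑removable B ν (λ w → transitionSum B j a f (removeBox w ν)) ∎
    where
    open ≡-Reasoning
    P = paths (suc j)
    D = cornerDiff B f ν
    Down : Path → ℤ
    Down q = ∑removable B ν (λ y → ∑removable B (shape q) (λ x →
               𝟙 (removeBox x (shape q) ≟ₛ removeBox y ν) * f (content x (removeBox x (shape q)))))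
    diagonal : ∑[ q ∈ P ] (a q * (𝟙 (shape q ≟ₛ ν) * D)) ≡ weightTo (suc j) a ν * D
    diagonal = trans (∑-cong P (λ q → rearrange (a q) (𝟙 (shape q ≟ₛ ν)) D)) (∑-*ʳ D P (λ q → 𝟙 (shape q ≟ₛ ν) * a q))
      where
      rearrange : ∀ u e d → u * (e * d) ≡ e * u * d
      rearrange = solve-∀

  -- Alternating corner sums of powers of the content

  content-suc : ∀ i l ls → content (suc i) (l ∷ ls) ≡ content i ls - + 1
  content-suc i l ls = content-shift (+ rowLen i ls) (+ i)
    where
    content-shift : ∀ r i → r - (+ 1 + i) ≡ (r - i) - + 1
    content-shift = solve-∀

  cornerTerm-suc : ∀ f l ls i → cornerTerm f (l ∷ ls) (suc (suc i)) ≡ cornerTerm (λ c → f (c - + 1)) ls (suc i)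
  cornerTerm-suc f l ls i = cong₂ (λ u v → 𝟙 (addable? (suc i) ls) * f u - 𝟙 (removable? (suc i) ls) * f v)
    (content-suc (suc i) l ls) (content-suc (suc i) l (removeBox (suc i) ls))

  cornerTerm-first-rows : ∀ f l ls → IsPartition (l ∷ ls) →
    cornerTerm f (l ∷ ls) 0 + cornerTerm f (l ∷ ls) 1 ≡ f (+ l) - f (+ l - + 1) + cornerTerm (λ c → f (c - + 1)) ls 0
  cornerTerm-first-rows f (suc l) ls (_ , row₁≤l , _) = begin
    + 1 * f (content 0 (suc l ∷ ls)) - 𝟙 d * f (content 0 (removeBox 0 (suc l ∷ ls)))
      + (𝟙 d * f (content 1 (suc l ∷ ls)) - 𝟙 r * f (content 1 (suc l ∷ removeBox 0 ls)))
      ≡⟨ cong₂ (λ u v → + 1 * f u - 𝟙 d * f v + (𝟙 d * f (content 1 (suc l ∷ ls)) - 𝟙 r * f (content 1 (suc l ∷ removeBox 0 ls))))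
               (ℤP.+-identityʳ (+ suc l)) (trans (ℤP.+-identityʳ _) (cong +_ (rowLen-consRow 0 l ls))) ⟩
    + 1 * F₀ - 𝟙 d * F₁ + (𝟙 d * f (content 1 (suc l ∷ ls)) - 𝟙 r * f (content 1 (suc l ∷ removeBox 0 ls)))
      ≡⟨ cong₂ (λ u v → + 1 * F₀ - 𝟙 d * F₁ + (𝟙 d * f u - 𝟙 r * f v)) (content-suc 0 (suc l) ls) (content-suc 0 (suc l) (removeBox 0 ls)) ⟩
    + 1 * F₀ - 𝟙 d * F₁ + (𝟙 d * G₀ - R)
      ≡⟨ by-cases d ⟩
    F₀ - F₁ + (+ 1 * G₀ - R) ∎
    where
    open ≡-Reasoning
    d = rowLen 0 ls ℕ.<? suc l
    r = removable? 0 ls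
    F₀ = f (+ suc l)
    F₁ = f (+ l)
    G₀ = f (content 0 ls - + 1)
    R = 𝟙 r * f (content 0 (removeBox 0 ls) - + 1)
    by-cases : (d : Dec (rowLen 0 ls ℕ.< suc l)) → + 1 * F₀ - 𝟙 d * F₁ + (𝟙 d * G₀ - R) ≡ F₀ - F₁ + (+ 1 * G₀ - R)
    by-cases (yes _) = rearrange F₀ F₁ G₀ R
      where
      rearrange : ∀ F₀ F₁ G₀ R → + 1 * F₀ - + 1 * F₁ + (+ 1 * G₀ - R) ≡ F₀ - F₁ + (+ 1 * G₀ - R)
      rearrange = solve-∀
    by-cases (no row₁≮) = trans (rearrange F₀ F₁ G₀ R) (cong (λ u → F₀ - F₁ + (+ 1 * u - R)) (sym G₀≡F₁))
      where
      rearrange : ∀ F₀ F₁ G₀ R → + 1 * F₀ - + 0 * F₁ + (+ 0 * G₀ - R) ≡ F₀ - F₁ + (+ 1 * F₁ - R)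
      rearrange = solve-∀
      G₀≡F₁ : G₀ ≡ F₁
      G₀≡F₁ = cong (λ u → f (u - + 1)) (trans (ℤP.+-identityʳ _) (cong +_ (ℕP.≤-antisym row₁≤l (ℕP.≮⇒≥ row₁≮))))

  cornerDiff-cons : ∀ B f l ls → IsPartition (l ∷ ls) →
    cornerDiff (suc (suc B)) f (l ∷ ls) ≡ f (+ l) - f (+ l - + 1) + cornerDiff (suc B) (λ c → f (c - + 1)) ls
  cornerDiff-cons B f l ls p = begin
    cornerDiff (suc (suc B)) f (l ∷ ls)
      ≡⟨ ∑<-shift (suc B) (cornerTerm f (l ∷ ls)) ⟩
    T 0 + ∑[ i < suc B ] T (suc i)
      ≡⟨ cong (_+_ (T 0)) (∑<-shift B (T ∘ suc)) ⟩
    T 0 + (T 1 + ∑[ i < B ] T (suc (suc i)))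
      ≡⟨ ℤP.+-assoc (T 0) (T 1) _ ⟨
    T 0 + T 1 + ∑[ i < B ] T (suc (suc i))
      ≡⟨ cong₂ _+_ (cornerTerm-first-rows f l ls p) (∑-cong (upTo B) (cornerTerm-suc f l ls)) ⟩
    f (+ l) - f (+ l - + 1) + cornerTerm g ls 0 + ∑[ i < B ] cornerTerm g ls (suc i)
      ≡⟨ ℤP.+-assoc (f (+ l) - f (+ l - + 1)) _ _ ⟩
    f (+ l) - f (+ l - + 1) + (cornerTerm g ls 0 + ∑[ i < B ] cornerTerm g ls (suc i))
      ≡⟨ cong (_+_ (f (+ l) - f (+ l - + 1))) (∑<-shift B (cornerTerm g ls)) ⟨
    f (+ l) - f (+ l - + 1) + cornerDiff (suc B) g ls ∎
    where
    open ≡-Reasoning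
    T = cornerTerm f (l ∷ ls)
    g : ℤ → ℤ
    g c = f (c - + 1)

  cornerDiff-cong : ∀ B ν {f g : ℤ → ℤ} → (∀ c → f c ≡ g c) → cornerDiff B f ν ≡ cornerDiff B g ν
  cornerDiff-cong B ν f≗g = ∑-cong (upTo B) (λ i →
    cong₂ (λ u v → 𝟙 (addable? i ν) * u - 𝟙 (removable? i ν) * v) (f≗g _) (f≗g _))

  content-shift : ∀ c a → c - + 1 + a ≡ c + (a - + 1)
  content-shift = solve-∀

  cornerDiff-[] : ∀ B f → 1 ℕ.≤ B → cornerDiff B f [] ≡ f (+ 0)
  cornerDiff-[] B f 1≤B = begin
    cornerDiff B f []                 ≡⟨ ∑<-vanishing (cornerTerm f []) 1≤B vanish ⟩
    + 1 * f (+ 0) - + 0 * f (+ 0) + + 0 ≡⟨ simplify (f (+ 0)) ⟩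
    f (+ 0)                           ∎
    where
    open ≡-Reasoning
    vanish : ∀ i → 1 ℕ.≤ i → cornerTerm f [] i ≡ + 0
    vanish (suc i) _ = refl
    simplify : ∀ a → + 1 * a - + 0 * a + + 0 ≡ a
    simplify = solve-∀

  square fourth : ℤ → ℤ
  square z = z * z
  fourth z = square z * square z

  -- ∑ (c + a)² over the cells of ν, where c is the content of the cell.
  ∑content² : ℤ → Shape → ℤ
  ∑content² a []       = + 0
  ∑content² a (l ∷ ls) = ∑[ k < l ] square (+ k + a) + ∑content² (a - + 1) ls

  ∑content²-addBox : ∀ x ν a → x ℕ.≤ length ν → ∑content² a (addBox x ν) ≡ ∑content² a ν + square (content x ν + a)
  ∑content²-addBox zero [] a _ = identity a
    where
    identity : ∀ a → (+ 0 + a) * (+ 0 + a) + + 0 + + 0 ≡ + 0 + (+ 0 - + 0 + a) * (+ 0 - + 0 + a)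
    identity = solve-∀
  ∑content²-addBox zero (l ∷ ls) a _ = begin
    ∑[ k < suc l ] square (+ k + a) + ∑content² (a - + 1) ls
      ≡⟨ cong (_+ ∑content² (a - + 1) ls) (∑<-suc l (λ k → square (+ k + a))) ⟩
    ∑[ k < l ] square (+ k + a) + square (+ l + a) + ∑content² (a - + 1) ls
      ≡⟨ rearrange (∑[ k < l ] square (+ k + a)) (∑content² (a - + 1) ls) (+ l) a ⟩
    ∑[ k < l ] square (+ k + a) + ∑content² (a - + 1) ls + square (+ l - + 0 + a) ∎
    where
    open ≡-Reasoning
    rearrange : ∀ R S L a → R + (L + a) * (L + a) + S ≡ R + S + (L - + 0 + a) * (L - + 0 + a)
    rearrange = solve-∀
  ∑content²-addBox (suc x) (l ∷ ls) a x<len = begin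
    ∑[ k < l ] square (+ k + a) + ∑content² (a - + 1) (addBox x ls)
      ≡⟨ cong (_+_ (∑[ k < l ] square (+ k + a))) (∑content²-addBox x ls (a - + 1) (ℕP.≤-pred x<len)) ⟩
    ∑[ k < l ] square (+ k + a) + (∑content² (a - + 1) ls + square (content x ls + (a - + 1)))
      ≡⟨ rearrange (∑[ k < l ] square (+ k + a)) (∑content² (a - + 1) ls) (content x ls) a ⟩
    ∑[ k < l ] square (+ k + a) + ∑content² (a - + 1) ls + square (content x ls - + 1 + a)
      ≡⟨ cong (λ c → ∑[ k < l ] square (+ k + a) + ∑content² (a - + 1) ls + square (c + a)) (content-suc x l ls) ⟨
    ∑content² a (l ∷ ls) + square (content (suc x) (l ∷ ls) + a) ∎
    where
    open ≡-Reasoning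
    rearrange : ∀ R S C a → R + (S + (C + (a - + 1)) * (C + (a - + 1))) ≡ R + S + (C - + 1 + a) * (C - + 1 + a)
    rearrange = solve-∀

  cornerDiff-one : ∀ {ν} B → IsPartition ν → suc (length ν) ℕ.≤ B → cornerDiff B (λ _ → + 1) ν ≡ + 1
  cornerDiff-one {[]}     B               _           1≤B             = cornerDiff-[] B (λ _ → + 1) 1≤B
  cornerDiff-one {l ∷ ls} (suc (suc B)) p@(_ , _ , pls) (s≤s len<B) =
    trans (cornerDiff-cons B (λ _ → + 1) l ls p) (cong (_+_ (+ 0)) (cornerDiff-one (suc B) pls len<B))

  cornerDiff-square : ∀ {ν} B a → IsPartition ν → suc (length ν) ℕ.≤ B →
    cornerDiff B (λ c → square (c + a)) ν ≡ square a + + 2 * + size ν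
  cornerDiff-square {[]} B a _ 1≤B = trans (cornerDiff-[] B (λ c → square (c + a)) 1≤B) (identity a)
    where
    identity : ∀ a → (+ 0 + a) * (+ 0 + a) ≡ a * a + + 2 * + 0
    identity = solve-∀
  cornerDiff-square {l ∷ ls} (suc (suc B)) a p@(_ , _ , pls) (s≤s len<B) = begin
    cornerDiff (suc (suc B)) (λ c → square (c + a)) (l ∷ ls)
      ≡⟨ cornerDiff-cons B (λ c → square (c + a)) l ls p ⟩
    square (+ l + a) - square (+ l - + 1 + a) + cornerDiff (suc B) (λ c → square (c - + 1 + a)) ls
      ≡⟨ cong (_+_ (square (+ l + a) - square (+ l - + 1 + a)))
              (trans (cornerDiff-cong (suc B) ls (λ c → cong square (content-shift c a))) (cornerDiff-square (suc B) (a - + 1) pls len<B)) ⟩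
    square (+ l + a) - square (+ l - + 1 + a) + (square (a - + 1) + + 2 * + size ls)
      ≡⟨ telescope (+ l) a (+ size ls) ⟩
    square a + + 2 * (+ l + + size ls) ∎
    where
    open ≡-Reasoning
    telescope : ∀ L a S → (L + a) * (L + a) - (L - + 1 + a) * (L - + 1 + a) + ((a - + 1) * (a - + 1) + + 2 * S)
                          ≡ a * a + + 2 * (L + S)
    telescope = solve-∀

  fourth-telescope : ∀ l a → fourth (+ l + a) - fourth (+ l - + 1 + a)
                             ≡ fourth a - fourth (a - + 1) + + 12 * ∑[ k < l ] square (+ k + a) + + 2 * + l
  fourth-telescope zero    a = base a
    where
    base : ∀ a → (+ 0 + a) * (+ 0 + a) * ((+ 0 + a) * (+ 0 + a)) - (+ 0 - + 1 + a) * (+ 0 - + 1 + a) * ((+ 0 - + 1 + a) * (+ 0 - + 1 + a))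
                 ≡ a * a * (a * a) - (a - + 1) * (a - + 1) * ((a - + 1) * (a - + 1)) + + 12 * + 0 + + 2 * + 0
    base = solve-∀
  fourth-telescope (suc l) a = begin
    fourth (+ suc l + a) - fourth (+ suc l - + 1 + a)
      ≡⟨ step (+ l) a ⟩
    fourth (+ l + a) - fourth (+ l - + 1 + a) + + 12 * square (+ l + a) + + 2
      ≡⟨ cong (λ t → t + + 12 * square (+ l + a) + + 2) (fourth-telescope l a) ⟩
    fourth a - fourth (a - + 1) + + 12 * ∑[ k < l ] square (+ k + a) + + 2 * + l + + 12 * square (+ l + a) + + 2
      ≡⟨ collect (fourth a - fourth (a - + 1)) (∑[ k < l ] square (+ k + a)) (square (+ l + a)) (+ l) ⟩
    fourth a - fourth (a - + 1) + + 12 * (∑[ k < l ] square (+ k + a) + square (+ l + a)) + + 2 * (+ 1 + + l)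
      ≡⟨ cong (λ t → fourth a - fourth (a - + 1) + + 12 * t + + 2 * + suc l) (∑<-suc l (λ k → square (+ k + a))) ⟨
    fourth a - fourth (a - + 1) + + 12 * ∑[ k < suc l ] square (+ k + a) + + 2 * + suc l ∎
    where
    open ≡-Reasoning
    step : ∀ L a → ((+ 1 + L) + a) * ((+ 1 + L) + a) * (((+ 1 + L) + a) * ((+ 1 + L) + a))
                   - ((+ 1 + L) - + 1 + a) * ((+ 1 + L) - + 1 + a) * (((+ 1 + L) - + 1 + a) * ((+ 1 + L) - + 1 + a))
                   ≡ (L + a) * (L + a) * ((L + a) * (L + a)) - (L - + 1 + a) * (L - + 1 + a) * ((L - + 1 + a) * (L - + 1 + a))
                     + + 12 * ((L + a) * (L + a)) + + 2
    step = solve-∀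
    collect : ∀ D R S L → D + + 12 * R + + 2 * L + + 12 * S + + 2 ≡ D + + 12 * (R + S) + + 2 * (+ 1 + L)
    collect = solve-∀

  cornerDiff-fourth : ∀ {ν} B a → IsPartition ν → suc (length ν) ℕ.≤ B →
    cornerDiff B (λ c → fourth (c + a)) ν ≡ fourth a + + 12 * ∑content² a ν + + 2 * + size ν
  cornerDiff-fourth {[]} B a _ 1≤B = trans (cornerDiff-[] B (λ c → fourth (c + a)) 1≤B) (identity a)
    where
    identity : ∀ a → (+ 0 + a) * (+ 0 + a) * ((+ 0 + a) * (+ 0 + a)) ≡ a * a * (a * a) + + 12 * + 0 + + 2 * + 0
    identity = solve-∀
  cornerDiff-fourth {l ∷ ls} (suc (suc B)) a p@(_ , _ , pls) (s≤s len<B) = begin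
    cornerDiff (suc (suc B)) (λ c → fourth (c + a)) (l ∷ ls)
      ≡⟨ cornerDiff-cons B (λ c → fourth (c + a)) l ls p ⟩
    fourth (+ l + a) - fourth (+ l - + 1 + a) + cornerDiff (suc B) (λ c → fourth (c - + 1 + a)) ls
      ≡⟨ cong₂ _+_ (fourth-telescope l a)
              (trans (cornerDiff-cong (suc B) ls (λ c → cong fourth (content-shift c a))) (cornerDiff-fourth (suc B) (a - + 1) pls len<B)) ⟩
    fourth a - fourth (a - + 1) + + 12 * R + + 2 * + l + (fourth (a - + 1) + + 12 * ∑content² (a - + 1) ls + + 2 * + size ls)
      ≡⟨ collect (fourth a) (fourth (a - + 1)) R (∑content² (a - + 1) ls) (+ l) (+ size ls) ⟩
    fourth a + + 12 * (R + ∑content² (a - + 1) ls) + + 2 * (+ l + + size ls) ∎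
    where
    open ≡-Reasoning
    R = ∑[ k < l ] square (+ k + a)
    collect : ∀ P Q R S L Z → P - Q + + 12 * R + + 2 * L + (Q + + 12 * S + + 2 * Z) ≡ P + + 12 * (R + S) + + 2 * (L + Z)
    collect = solve-∀

  -- Moments of the content of the added cell

  transitionSum-step : ∀ {j a} B f d c {ν} → IsPartition ν → suc (suc j) ℕ.≤ B → Extends j a a → Extends (suc j) a a →
    cornerDiff B f ν ≡ d → (∀ w → Removable w ν → transitionSum B j a f (removeBox w ν) ≡ c * weightTo j a (removeBox w ν)) →
    transitionSum B (suc j) a f ν ≡ (d + c) * weightTo (suc j) a ν
  transitionSum-step {j} {a} B f d c {ν} pν j<B ext ext′ diff ih = begin
    transitionSum B (suc j) a f ν
      ≡⟨ transitionSum-commutation B f pν ext′ j<B ⟩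
    G * cornerDiff B f ν + ∑removable B ν (λ w → transitionSum B j a f (removeBox w ν))
      ≡⟨ cong₂ (λ u v → G * u + v) diff (∑<∣-cong (λ w → removable? w ν) B ih) ⟩
    G * d + ∑removable B ν (λ w → c * weightTo j a (removeBox w ν))
      ≡⟨ cong (_+_ (G * d)) (∑<∣-*ˡ (λ w → removable? w ν) B c (λ w → weightTo j a (removeBox w ν))) ⟩
    G * d + c * ∑removable B ν (λ w → weightTo j a (removeBox w ν))
      ≡⟨ cong (λ u → G * d + c * u) (weightTo-suc B pν ext (ℕP.≤-trans (ℕP.n≤1+n _) j<B)) ⟨
    G * d + c * G
      ≡⟨ rearrange G d c ⟩
    (d + c) * G ∎
    where
    open ≡-Reasoning
    G = weightTo (suc j) a ν
    rearrange : ∀ G d c → G * d + c * G ≡ (d + c) * G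
    rearrange = solve-∀

  one : Path → ℤ
  one _ = + 1

  transitionSum-one : ∀ j {ν} B → IsPartition ν → size ν ≡ j → suc j ℕ.≤ B →
    transitionSum B j one (λ _ → + 1) ν ≡ + suc j * weightTo j one ν
  transitionSum-one zero B pν sν 1≤B with size≡0⇒[] pν sν
  ... | refl = ∑addable-bound [] _ ℕP.≤-refl 1≤B
  transitionSum-one (suc j) {ν} B pν sν j<B =
    transitionSum-step B (λ _ → + 1) (+ 1) (+ suc j) pν j<B (λ _ _ _ → refl) (λ _ _ _ → refl)
      (cornerDiff-one B pν (length<bound pν sν j<B))
      (λ w r → transitionSum-one j B (removeBox-isPartition pν w r) (size-removeBox-pred {ν} w r sν) (ℕP.≤-trans (ℕP.n≤1+n _) j<B))

  transitionSum-square : ∀ j {ν} B → IsPartition ν → size ν ≡ j → suc j ℕ.≤ B →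
    transitionSum B j one square ν ≡ + j * + suc j * weightTo j one ν
  transitionSum-square zero B pν sν 1≤B with size≡0⇒[] pν sν
  ... | refl = ∑addable-bound [] _ ℕP.≤-refl 1≤B
  transitionSum-square (suc j) {ν} B pν sν j<B = trans
    (transitionSum-step B square (+ 2 * + suc j) (+ j * + suc j) pν j<B (λ _ _ _ → refl) (λ _ _ _ → refl) diff
      (λ w r → transitionSum-square j B (removeBox-isPartition pν w r) (size-removeBox-pred {ν} w r sν) (ℕP.≤-trans (ℕP.n≤1+n _) j<B)))
    (cong (_* weightTo (suc j) one ν) (collect (+ j)))
    where
    diff : cornerDiff B square ν ≡ + 2 * + suc j
    diff = begin
      cornerDiff B square ν                          ≡⟨ cornerDiff-cong B ν (λ c → cong square (sym (ℤP.+-identityʳ c))) ⟩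
      cornerDiff B (λ c → square (c + + 0)) ν        ≡⟨ cornerDiff-square B (+ 0) pν (length<bound pν sν j<B) ⟩
      square (+ 0) + + 2 * + size ν                  ≡⟨ ℤP.+-identityˡ _ ⟩
      + 2 * + size ν                                 ≡⟨ cong (λ n → + 2 * + n) sν ⟩
      + 2 * + suc j                                  ∎
      where open ≡-Reasoning
    collect : ∀ J → + 2 * (+ 1 + J) + J * (+ 1 + J) ≡ (+ 1 + J) * (+ 1 + (+ 1 + J))
    collect = solve-∀

  -- +1 if the first two cells lie in one row, −1 if they lie in one column, so
  -- that weightTo with these weights is the Murnaghan–Nakayama count charTransp.
  dominoSign : Path → ℤ
  dominoSign q = + secondRowIs 0 q - + secondRowIs 1 q

  dominoSign-extends : ∀ k → Extends (suc (suc k)) dominoSign dominoSign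
  dominoSign-extends k r (s ∷ t ∷ p) _ = refl

  size≡2 : ∀ {ν} → IsPartition ν → size ν ≡ 2 → ν ≡ 2 ∷ [] ⊎ ν ≡ 1 ∷ 1 ∷ []
  size≡2 {1 ∷ 1 ∷ []}       _                   _  = inj₂ refl
  size≡2 {2 ∷ []}           _                   _  = inj₁ refl
  size≡2 {zero ∷ _}         (() , _)
  size≡2 {1 ∷ zero ∷ _}     (_ , _ , () , _)
  size≡2 {1 ∷ 1 ∷ zero ∷ _} (_ , _ , _ , _ , () , _)
  size≡2 {2 ∷ zero ∷ _}     (_ , _ , () , _)

  transitionSum-sign : ∀ k {ν} B → IsPartition ν → size ν ≡ suc (suc k) → suc (suc (suc k)) ℕ.≤ B →
    transitionSum B (suc (suc k)) dominoSign (λ _ → + 1) ν ≡ + suc k * weightTo (suc (suc k)) dominoSign ν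
  transitionSum-sign zero B pν sν 3≤B with size≡2 pν sν
  ... | inj₁ refl = ∑addable-bound (2 ∷ []) _ ℕP.≤-refl (ℕP.≤-trans (ℕP.n≤1+n _) 3≤B)
  ... | inj₂ refl = ∑addable-bound (1 ∷ 1 ∷ []) _ ℕP.≤-refl 3≤B
  transitionSum-sign (suc k) {ν} B pν sν k<B =
    transitionSum-step B (λ _ → + 1) (+ 1) (+ suc k) pν k<B (dominoSign-extends k) (dominoSign-extends (suc k))
      (cornerDiff-one B pν (length<bound pν sν k<B))
      (λ w r → transitionSum-sign k B (removeBox-isPartition pν w r) (size-removeBox-pred {ν} w r sν) (ℕP.≤-trans (ℕP.n≤1+n _) k<B))

  ∑paths-dim : ∀ m → ∑[ q ∈ paths m ] weightTo m one (shape q) ≡ + (m !)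
  ∑paths-dim zero    = refl
  ∑paths-dim (suc m) = begin
    ∑[ p ∈ paths (suc m) ] weightTo (suc m) one (shape p)
      ≡⟨ ∑paths-suc m (suc m) (λ p → weightTo (suc m) one (shape p)) ℕP.≤-refl ⟩
    ∑[ q ∈ paths m ] ∑addable (suc m) (shape q) (λ r → weightTo (suc m) one (addBox r (shape q)))
      ≡⟨ ∑-congᴬ (paths-wellFormed m) (λ q (p , s , _) →
           trans (∑<∣-cong (λ r → addable? r (shape q)) (suc m) (λ r _ → sym (ℤP.*-identityˡ (weightTo (suc m) one (addBox r (shape q))))))
                 (transitionSum-one m (suc m) p s ℕP.≤-refl)) ⟩
    ∑[ q ∈ paths m ] (+ suc m * weightTo m one (shape q))
      ≡⟨ ∑-*ˡ (+ suc m) (paths m) (λ q → weightTo m one (shape q)) ⟩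
    + suc m * ∑[ q ∈ paths m ] weightTo m one (shape q)
      ≡⟨ cong (+ suc m *_) (∑paths-dim m) ⟩
    + suc m * + (m !)
      ≡⟨ ℤP.pos-* (suc m) (m !) ⟨
    + (suc m !) ∎
    where open ≡-Reasoning

  plancherel-∑content² : ℕ → ℤ
  plancherel-∑content² m = ∑[ q ∈ paths m ] (weightTo m one (shape q) * ∑content² (+ 0) (shape q))

  ∑addable-dim-∑content² : ∀ m {κ} → IsPartition κ → size κ ≡ m →
    ∑addable (suc m) κ (λ r → weightTo (suc m) one (addBox r κ) * ∑content² (+ 0) (addBox r κ))
    ≡ + suc m * (weightTo m one κ * ∑content² (+ 0) κ) + + m * + suc m * weightTo m one κ
  ∑addable-dim-∑content² m {κ} p s = begin
    ∑addable (suc m) κ (λ r → G r * ∑content² (+ 0) (addBox r κ))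
      ≡⟨ ∑<∣-cong (λ r → addable? r κ) (suc m) (λ r a → trans
           (cong (G r *_) (trans (∑content²-addBox r κ (+ 0) (addable⇒≤length r a))
                                 (cong (λ c → S + square c) (ℤP.+-identityʳ (content r κ)))))
           (split (G r) S (square (content r κ)))) ⟩
    ∑addable (suc m) κ (λ r → S * (+ 1 * G r) + square (content r κ) * G r)
      ≡⟨ ∑<∣-+ (λ r → addable? r κ) (suc m) (λ r → S * (+ 1 * G r)) (λ r → square (content r κ) * G r) ⟩
    ∑addable (suc m) κ (λ r → S * (+ 1 * G r)) + transitionSum (suc m) m one square κ
      ≡⟨ cong (_+ transitionSum (suc m) m one square κ) (∑<∣-*ˡ (λ r → addable? r κ) (suc m) S (λ r → + 1 * G r)) ⟩
    S * transitionSum (suc m) m one (λ _ → + 1) κ + transitionSum (suc m) m one square κ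
      ≡⟨ cong₂ (λ u v → S * u + v) (transitionSum-one m (suc m) p s ℕP.≤-refl) (transitionSum-square m (suc m) p s ℕP.≤-refl) ⟩
    S * (+ suc m * weightTo m one κ) + + m * + suc m * weightTo m one κ
      ≡⟨ cong (_+ + m * + suc m * weightTo m one κ) (exchange S (+ suc m) (weightTo m one κ)) ⟩
    + suc m * (weightTo m one κ * S) + + m * + suc m * weightTo m one κ ∎
    where
    open ≡-Reasoning
    S = ∑content² (+ 0) κ
    G : ℕ → ℤ
    G r = weightTo (suc m) one (addBox r κ)
    split : ∀ g s c → g * (s + c) ≡ s * (+ 1 * g) + c * g
    split = solve-∀
    exchange : ∀ s k g → s * (k * g) ≡ k * (g * s)
    exchange = solve-∀

  plancherel-∑content²-suc : ∀ m →
    plancherel-∑content² (suc m) ≡ + suc m * plancherel-∑content² m + + m * + suc m * + (m !)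
  plancherel-∑content²-suc m = begin
    plancherel-∑content² (suc m)
      ≡⟨ ∑paths-suc m (suc m) (λ p → weightTo (suc m) one (shape p) * ∑content² (+ 0) (shape p)) ℕP.≤-refl ⟩
    ∑[ q ∈ paths m ] ∑addable (suc m) (shape q) (λ r → weightTo (suc m) one (addBox r (shape q)) * ∑content² (+ 0) (addBox r (shape q)))
      ≡⟨ ∑-congᴬ (paths-wellFormed m) (λ q (p , s , _) → ∑addable-dim-∑content² m p s) ⟩
    ∑[ q ∈ paths m ] (+ suc m * (weightTo m one (shape q) * ∑content² (+ 0) (shape q)) + + m * + suc m * weightTo m one (shape q))
      ≡⟨ ∑-+ (paths m) (λ q → + suc m * (weightTo m one (shape q) * ∑content² (+ 0) (shape q)))
                       (λ q → + m * + suc m * weightTo m one (shape q)) ⟩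
    ∑[ q ∈ paths m ] (+ suc m * (weightTo m one (shape q) * ∑content² (+ 0) (shape q)))
      + ∑[ q ∈ paths m ] (+ m * + suc m * weightTo m one (shape q))
      ≡⟨ cong₂ _+_ (∑-*ˡ (+ suc m) (paths m) (λ q → weightTo m one (shape q) * ∑content² (+ 0) (shape q)))
                   (trans (∑-*ˡ (+ m * + suc m) (paths m) (λ q → weightTo m one (shape q))) (cong (+ m * + suc m *_) (∑paths-dim m))) ⟩
    + suc m * plancherel-∑content² m + + m * + suc m * + (m !) ∎
    where open ≡-Reasoning

  plancherel-∑content²-closed : ∀ m → plancherel-∑content² m * + 2 ≡ + (m !) * + m * (+ m - + 1)
  plancherel-∑content²-closed zero    = refl
  plancherel-∑content²-closed (suc m) = begin
    plancherel-∑content² (suc m) * + 2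
      ≡⟨ cong (_* + 2) (plancherel-∑content²-suc m) ⟩
    (+ suc m * plancherel-∑content² m + + m * + suc m * + (m !)) * + 2
      ≡⟨ distribute (+ suc m) (plancherel-∑content² m) (+ m) (+ (m !)) ⟩
    + suc m * (plancherel-∑content² m * + 2) + + 2 * (+ m * + suc m * + (m !))
      ≡⟨ cong (λ t → + suc m * t + + 2 * (+ m * + suc m * + (m !))) (plancherel-∑content²-closed m) ⟩
    + suc m * (+ (m !) * + m * (+ m - + 1)) + + 2 * (+ m * + suc m * + (m !))
      ≡⟨ collect (+ m) (+ (m !)) ⟩
    + suc m * + (m !) * + suc m * (+ suc m - + 1)
      ≡⟨ cong (λ t → t * + suc m * (+ suc m - + 1)) (ℤP.pos-* (suc m) (m !)) ⟨
    + (suc m !) * + suc m * (+ suc m - + 1) ∎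
    where
    open ≡-Reasoning
    distribute : ∀ S V J F → (S * V + J * S * F) * + 2 ≡ S * (V * + 2) + + 2 * (J * S * F)
    distribute = solve-∀
    collect : ∀ J F → (+ 1 + J) * (F * J * (J - + 1)) + + 2 * (J * (+ 1 + J) * F) ≡ (+ 1 + J) * F * (+ 1 + J) * ((+ 1 + J) - + 1)
    collect = solve-∀

  plancherel-sign : ℕ → ℤ
  plancherel-sign m = ∑[ q ∈ paths m ] (dominoSign q * weightTo m dominoSign (shape q))

  ∑addable-sign : ∀ k q → let j = suc (suc k) in IsPartition (shape q) → size (shape q) ≡ j → length q ≡ j →
    ∑addable (suc j) (shape q) (λ r → dominoSign (r ∷ q) * weightTo (suc j) dominoSign (addBox r (shape q)))
    ≡ + suc k * (dominoSign q * weightTo j dominoSign (shape q))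
  ∑addable-sign k q p s len = begin
    ∑addable (suc j) (shape q) (λ r → dominoSign (r ∷ q) * weightTo (suc j) dominoSign (addBox r (shape q)))
      ≡⟨ ∑<∣-cong (λ r → addable? r (shape q)) (suc j) (λ r _ →
           trans (cong (_* weightTo (suc j) dominoSign (addBox r (shape q))) (dominoSign-extends k r q len))
                 (cong (dominoSign q *_) (sym (ℤP.*-identityˡ _)))) ⟩
    ∑addable (suc j) (shape q) (λ r → dominoSign q * (+ 1 * weightTo (suc j) dominoSign (addBox r (shape q))))
      ≡⟨ ∑<∣-*ˡ (λ r → addable? r (shape q)) (suc j) (dominoSign q) _ ⟩
    dominoSign q * transitionSum (suc j) j dominoSign (λ _ → + 1) (shape q)
      ≡⟨ cong (dominoSign q *_) (transitionSum-sign k (suc j) p s ℕP.≤-refl) ⟩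
    dominoSign q * (+ suc k * weightTo j dominoSign (shape q))
      ≡⟨ exchange (dominoSign q) (+ suc k) _ ⟩
    + suc k * (dominoSign q * weightTo j dominoSign (shape q)) ∎
    where
    open ≡-Reasoning
    j = suc (suc k)
    exchange : ∀ a b c → a * (b * c) ≡ b * (a * c)
    exchange = solve-∀

  plancherel-sign-closed : ∀ k → plancherel-sign (suc (suc k)) ≡ + 2 * + (k !)
  plancherel-sign-closed zero    = refl
  plancherel-sign-closed (suc k) = begin
    plancherel-sign (suc j)
      ≡⟨ ∑paths-suc j (suc j) (λ p → dominoSign p * weightTo (suc j) dominoSign (shape p)) ℕP.≤-refl ⟩
    ∑[ q ∈ paths j ] ∑addable (suc j) (shape q) (λ r → dominoSign (r ∷ q) * weightTo (suc j) dominoSign (addBox r (shape q)))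
      ≡⟨ ∑-congᴬ (paths-wellFormed j) (λ q (p , s , len) → ∑addable-sign k q p s len) ⟩
    ∑[ q ∈ paths j ] (+ suc k * (dominoSign q * weightTo j dominoSign (shape q)))
      ≡⟨ ∑-*ˡ (+ suc k) (paths j) (λ q → dominoSign q * weightTo j dominoSign (shape q)) ⟩
    + suc k * plancherel-sign j
      ≡⟨ cong (+ suc k *_) (plancherel-sign-closed k) ⟩
    + suc k * (+ 2 * + (k !))
      ≡⟨ exchange (+ suc k) (+ 2) (+ (k !)) ⟩
    + 2 * (+ suc k * + (k !))
      ≡⟨ cong (+ 2 *_) (ℤP.pos-* (suc k) (k !)) ⟨
    + 2 * + (suc k !) ∎
    where
    open ≡-Reasoning
    j = suc (suc k)
    exchange : ∀ a b c → a * (b * c) ≡ b * (a * c)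
    exchange = solve-∀

  removal-count : ∀ j B {σ} → IsPartition σ → size σ ≡ j → suc (suc j) ℕ.≤ B →
    ∑[ q ∈ paths (suc j) ] ∑removable B (shape q) (λ w → 𝟙 (removeBox w (shape q) ≟ₛ σ)) ≡ + suc j * weightTo j one σ
  removal-count j B {σ} pσ sσ j<B = begin
    ∑[ q ∈ paths (suc j) ] ∑removable B (shape q) (λ w → 𝟙 (removeBox w (shape q) ≟ₛ σ))
      ≡⟨ ∑-cong (paths (suc j)) (λ q → trans
           (∑<∣-cong (λ w → removable? w (shape q)) B (λ w _ → sym (ℤP.*-identityʳ (𝟙 (removeBox w (shape q) ≟ₛ σ)))))
           (sym (ℤP.*-identityˡ _))) ⟩
    ∑[ q ∈ paths (suc j) ] (one q * ∑removable B (shape q) (λ w → 𝟙 (removeBox w (shape q) ≟ₛ σ) * + 1))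
      ≡⟨ transfer pσ j B one (λ _ → + 1) ⟩
    transitionSum B j one (λ _ → + 1) σ
      ≡⟨ transitionSum-one j B pσ sσ (ℕP.≤-trans (ℕP.n≤1+n _) j<B) ⟩
    + suc j * weightTo j one σ ∎
    where open ≡-Reasoning

  ∑paths-removable-dim : ∀ j B f →
    ∑[ p ∈ paths (suc j) ] ∑removable B (shape p) (λ x → f (content x (removeBox x (shape p))) * weightTo j one (removeBox x (shape p)))
    ≡ ∑[ q ∈ paths j ] transitionSum B j one f (shape q)
  ∑paths-removable-dim j B f = begin
    ∑[ p ∈ P ] ∑removable B (shape p) (λ x → F p x * weightTo j one (removeBox x (shape p)))
      ≡⟨ ∑-cong P (λ p → ∑<∣-cong (λ x → removable? x (shape p)) B (λ x _ → sym (∑-*ˡ (F p x) (paths j) (Eq p x)))) ⟩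
    ∑[ p ∈ P ] ∑removable B (shape p) (λ x → ∑[ q ∈ paths j ] (F p x * Eq p x q))
      ≡⟨ ∑-cong P (λ p → sym (∑-∑<∣-comm (λ x → removable? x (shape p)) B (paths j) (λ q x → F p x * Eq p x q))) ⟩
    ∑[ p ∈ P ] ∑[ q ∈ paths j ] ∑removable B (shape p) (λ x → F p x * Eq p x q)
      ≡⟨ ∑-comm P (paths j) (λ p q → ∑removable B (shape p) (λ x → F p x * Eq p x q)) ⟩
    ∑[ q ∈ paths j ] ∑[ p ∈ P ] ∑removable B (shape p) (λ x → F p x * Eq p x q)
      ≡⟨ ∑-cong (paths j) (λ q → ∑-cong P (λ p → trans
           (∑<∣-cong (λ x → removable? x (shape p)) B (λ x _ → reorder p x q)) (sym (ℤP.*-identityˡ _)))) ⟩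
    ∑[ q ∈ paths j ] ∑[ p ∈ P ] (one p * ∑removable B (shape p) (λ x → 𝟙 (removeBox x (shape p) ≟ₛ shape q) * F p x))
      ≡⟨ ∑-congᴬ (paths-wellFormed j) (λ q wf → transfer (proj₁ wf) j B one f) ⟩
    ∑[ q ∈ paths j ] transitionSum B j one f (shape q) ∎
    where
    open ≡-Reasoning
    P = paths (suc j)
    F : Path → ℕ → ℤ
    F p x = f (content x (removeBox x (shape p)))
    Eq : Path → ℕ → Path → ℤ
    Eq p x q = 𝟙 (shape q ≟ₛ removeBox x (shape p)) * one q
    reorder : ∀ p x q → F p x * Eq p x q ≡ 𝟙 (removeBox x (shape p) ≟ₛ shape q) * F p x
    reorder p x q = begin
      F p x * (𝟙 (shape q ≟ₛ removeBox x (shape p)) * + 1) ≡⟨ cong (F p x *_) (ℤP.*-identityʳ _) ⟩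
      F p x * 𝟙 (shape q ≟ₛ removeBox x (shape p))         ≡⟨ ℤP.*-comm (F p x) _ ⟩
      𝟙 (shape q ≟ₛ removeBox x (shape p)) * F p x         ≡⟨ cong (_* F p x) (𝟙-≟ₛ-sym (shape q) (removeBox x (shape p))) ⟩
      𝟙 (removeBox x (shape p) ≟ₛ shape q) * F p x         ∎

  removal-multiplicity : ∀ j B g {σ} → IsPartition σ → size σ ≡ j → suc (suc j) ℕ.≤ B →
    ∑[ q ∈ paths (suc j) ] ∑removable B (shape q) (λ w → 𝟙 (σ ≟ₛ removeBox w (shape q)) * g) ≡ + suc j * (g * weightTo j one σ)
  removal-multiplicity j B g {σ} pσ sσ j<B = begin
    ∑[ q ∈ P ] ∑removable B (shape q) (λ w → 𝟙 (σ ≟ₛ removeBox w (shape q)) * g)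
      ≡⟨ ∑-cong P (λ q → trans (∑<∣-cong (λ w → removable? w (shape q)) B (λ w _ →
           cong (_* g) (𝟙-≟ₛ-sym σ (removeBox w (shape q)))))
           (∑<∣-*ʳ (λ w → removable? w (shape q)) B g (λ w → 𝟙 (removeBox w (shape q) ≟ₛ σ)))) ⟩
    ∑[ q ∈ P ] (∑removable B (shape q) (λ w → 𝟙 (removeBox w (shape q) ≟ₛ σ)) * g)
      ≡⟨ ∑-*ʳ g P (λ q → ∑removable B (shape q) (λ w → 𝟙 (removeBox w (shape q) ≟ₛ σ))) ⟩
    ∑[ q ∈ P ] ∑removable B (shape q) (λ w → 𝟙 (removeBox w (shape q) ≟ₛ σ)) * g
      ≡⟨ cong (_* g) (removal-count j B pσ sσ j<B) ⟩
    + suc j * weightTo j one σ * g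
      ≡⟨ rearrange (+ suc j) (weightTo j one σ) g ⟩
    + suc j * (g * weightTo j one σ) ∎
    where
    open ≡-Reasoning
    P = paths (suc j)
    rearrange : ∀ k d g → k * d * g ≡ k * (g * d)
    rearrange = solve-∀

  ∑paths-removable-transitionSum : ∀ j B f → suc (suc j) ℕ.≤ B →
    ∑[ q ∈ paths (suc j) ] ∑removable B (shape q) (λ w → transitionSum B j one f (removeBox w (shape q)))
    ≡ + suc j * ∑[ q ∈ paths j ] transitionSum B j one f (shape q)
  ∑paths-removable-transitionSum j B f j<B = begin
    ∑[ q ∈ P ] ∑removable B (shape q) (λ w → transitionSum B j one f (removeBox w (shape q)))
      ≡⟨ ∑-congᴬ (paths-wellFormed (suc j)) (λ q wf → ∑<∣-cong (λ w → removable? w (shape q)) B (λ w r →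
           sym (trans (∑-cong P (λ p → sym (ℤP.*-identityˡ (∑removable B (shape p) (λ x → T q w p x)))))
                      (transfer (removeBox-isPartition (proj₁ wf) w r) j B one f)))) ⟩
    ∑[ q ∈ P ] ∑removable B (shape q) (λ w → ∑[ p ∈ P ] ∑removable B (shape p) (λ x → T q w p x))
      ≡⟨ ∑∑<∣-comm P P B B (λ q w → removable? w (shape q)) (λ p x → removable? x (shape p)) T ⟩
    ∑[ p ∈ P ] ∑removable B (shape p) (λ x → ∑[ q ∈ P ] ∑removable B (shape q) (λ w → T q w p x))
      ≡⟨ ∑-congᴬ (paths-wellFormed (suc j)) (λ p (pp , sp , _) → ∑<∣-cong (λ x → removable? x (shape p)) B (λ x r →
           removal-multiplicity j B (F p x) (removeBox-isPartition pp x r) (size-removeBox-pred {shape p} x r sp) j<B)) ⟩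
    ∑[ p ∈ P ] ∑removable B (shape p) (λ x → + suc j * (F p x * weightTo j one (removeBox x (shape p))))
      ≡⟨ ∑-cong P (λ p → ∑<∣-*ˡ (λ x → removable? x (shape p)) B (+ suc j) _) ⟩
    ∑[ p ∈ P ] (+ suc j * ∑removable B (shape p) (λ x → F p x * weightTo j one (removeBox x (shape p))))
      ≡⟨ ∑-*ˡ (+ suc j) P _ ⟩
    + suc j * ∑[ p ∈ P ] ∑removable B (shape p) (λ x → F p x * weightTo j one (removeBox x (shape p)))
      ≡⟨ cong (+ suc j *_) (∑paths-removable-dim j B f) ⟩
    + suc j * ∑[ q ∈ paths j ] transitionSum B j one f (shape q) ∎
    where
    open ≡-Reasoning
    P = paths (suc j)
    F : Path → ℕ → ℤ
    F p x = f (content x (removeBox x (shape p)))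
    T : Path → ℕ → Path → ℕ → ℤ
    T q w p x = 𝟙 (removeBox x (shape p) ≟ₛ removeBox w (shape q)) * F p x

  plancherel-fourth : ℕ → ℕ → ℤ
  plancherel-fourth B m = ∑[ q ∈ paths m ] transitionSum B m one fourth (shape q)

  cornerDiff-fourth₀ : ∀ {κ n} B → IsPartition κ → size κ ≡ n → suc n ℕ.≤ B →
    cornerDiff B fourth κ ≡ + 12 * ∑content² (+ 0) κ + + 2 * + n
  cornerDiff-fourth₀ {κ} {n} B p refl n<B = begin
    cornerDiff B fourth κ                                             ≡⟨ cornerDiff-cong B κ (λ c → cong fourth (sym (ℤP.+-identityʳ c))) ⟩
    cornerDiff B (λ c → fourth (c + + 0)) κ                           ≡⟨ cornerDiff-fourth B (+ 0) p (length<bound p refl n<B) ⟩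
    fourth (+ 0) + + 12 * ∑content² (+ 0) κ + + 2 * + size κ          ≡⟨ cong (_+ + 2 * + size κ) (ℤP.+-identityˡ (+ 12 * ∑content² (+ 0) κ)) ⟩
    + 12 * ∑content² (+ 0) κ + + 2 * + size κ                         ∎
    where open ≡-Reasoning

  plancherel-fourth-suc : ∀ j B → suc (suc j) ℕ.≤ B →
    plancherel-fourth B (suc j)
    ≡ + 12 * plancherel-∑content² (suc j) + + 2 * + suc j * + (suc j !) + + suc j * plancherel-fourth B j
  plancherel-fourth-suc j B j<B = begin
    ∑[ q ∈ P ] transitionSum B (suc j) one fourth (shape q)
      ≡⟨ ∑-congᴬ (paths-wellFormed (suc j)) (λ q wf → transitionSum-commutation B fourth (proj₁ wf) (λ _ _ _ → refl) j<B) ⟩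
    ∑[ q ∈ P ] (G q * cornerDiff B fourth (shape q) + ∑removable B (shape q) (λ w → transitionSum B j one fourth (removeBox w (shape q))))
      ≡⟨ ∑-+ P (λ q → G q * cornerDiff B fourth (shape q)) _ ⟩
    ∑[ q ∈ P ] (G q * cornerDiff B fourth (shape q)) + ∑[ q ∈ P ] ∑removable B (shape q) (λ w → transitionSum B j one fourth (removeBox w (shape q)))
      ≡⟨ cong₂ _+_ corner-part (∑paths-removable-transitionSum j B fourth j<B) ⟩
    + 12 * plancherel-∑content² (suc j) + + 2 * + suc j * + (suc j !) + + suc j * plancherel-fourth B j ∎
    where
    open ≡-Reasoning
    P = paths (suc j)
    G : Path → ℤ
    G q = weightTo (suc j) one (shape q)
    corner : ∀ q → WellFormed (suc j) q →
      G q * cornerDiff B fourth (shape q) ≡ + 12 * (G q * ∑content² (+ 0) (shape q)) + + 2 * + suc j * G q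
    corner q (p , s , _) = trans (cong (G q *_) (cornerDiff-fourth₀ B p s j<B)) (expand (G q) (∑content² (+ 0) (shape q)) (+ suc j))
      where
      expand : ∀ g s n → g * (+ 12 * s + + 2 * n) ≡ + 12 * (g * s) + + 2 * n * g
      expand = solve-∀
    corner-part : ∑[ q ∈ P ] (G q * cornerDiff B fourth (shape q)) ≡ + 12 * plancherel-∑content² (suc j) + + 2 * + suc j * + (suc j !)
    corner-part = begin
      ∑[ q ∈ P ] (G q * cornerDiff B fourth (shape q))
        ≡⟨ ∑-congᴬ (paths-wellFormed (suc j)) corner ⟩
      ∑[ q ∈ P ] (+ 12 * (G q * ∑content² (+ 0) (shape q)) + + 2 * + suc j * G q)
        ≡⟨ ∑-+ P (λ q → + 12 * (G q * ∑content² (+ 0) (shape q))) (λ q → + 2 * + suc j * G q) ⟩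
      ∑[ q ∈ P ] (+ 12 * (G q * ∑content² (+ 0) (shape q))) + ∑[ q ∈ P ] (+ 2 * + suc j * G q)
        ≡⟨ cong₂ _+_ (∑-*ˡ (+ 12) P (λ q → G q * ∑content² (+ 0) (shape q)))
                     (trans (∑-*ˡ (+ 2 * + suc j) P G) (cong (+ 2 * + suc j *_) (∑paths-dim (suc j)))) ⟩
      + 12 * plancherel-∑content² (suc j) + + 2 * + suc j * + (suc j !) ∎

  plancherel-fourth-closed : ∀ m B → suc m ℕ.≤ B → plancherel-fourth B m ≡ + (suc m !) * + m * (+ 2 * + m - + 1)
  plancherel-fourth-closed zero    B 1≤B = cong (_+ + 0) (∑addable-bound [] _ ℕP.≤-refl 1≤B)
  plancherel-fourth-closed (suc j) B j<B = begin
    plancherel-fourth B (suc j)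
      ≡⟨ plancherel-fourth-suc j B j<B ⟩
    + 12 * plancherel-∑content² (suc j) + + 2 * + suc j * F + + suc j * plancherel-fourth B j
      ≡⟨ cong₂ (λ u v → u + + 2 * + suc j * F + + suc j * v)
               (trans (double (plancherel-∑content² (suc j))) (cong (+ 6 *_) (plancherel-∑content²-closed (suc j))))
               (plancherel-fourth-closed j B (ℕP.≤-trans (ℕP.n≤1+n _) j<B)) ⟩
    + 6 * (F * + suc j * (+ suc j - + 1)) + + 2 * + suc j * F + + suc j * (F * + j * (+ 2 * + j - + 1))
      ≡⟨ collect (+ j) F ⟩
    (+ 1 + (+ 1 + + j)) * F * + suc j * (+ 2 * + suc j - + 1)
      ≡⟨ cong (λ t → t * + suc j * (+ 2 * + suc j - + 1)) (ℤP.pos-* (suc (suc j)) (suc j !)) ⟨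
    + (suc (suc j) !) * + suc j * (+ 2 * + suc j - + 1) ∎
    where
    open ≡-Reasoning
    F = + (suc j !)
    double : ∀ V → + 12 * V ≡ + 6 * (V * + 2)
    double = solve-∀
    collect : ∀ J F → + 6 * (F * (+ 1 + J) * ((+ 1 + J) - + 1)) + + 2 * (+ 1 + J) * F + (+ 1 + J) * (F * J * (+ 2 * J - + 1))
                      ≡ (+ 1 + (+ 1 + J)) * F * (+ 1 + J) * (+ 2 * (+ 1 + J) - + 1)
    collect = solve-∀

  count-∑ : ∀ {B : Set} (f : B → ℕ) xs → + count f xs ≡ ∑[ x ∈ xs ] (+ f x)
  count-∑ f []       = refl
  count-∑ f (x ∷ xs) = trans (ℤP.pos-+ (f x) (count f xs)) (cong (_+_ (+ f x)) (count-∑ f xs))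

  ∑-- : ∀ {B : Set} xs (f g : B → ℤ) → ∑[ x ∈ xs ] (f x - g x) ≡ ∑ xs f - ∑ xs g
  ∑-- []       f g = refl
  ∑-- (x ∷ xs) f g = trans (cong (_+_ (f x - g x)) (∑-- xs f g)) (rearrange (f x) (g x) (∑ xs f) (∑ xs g))
    where
    rearrange : ∀ a b c d → a - b + (c - d) ≡ a + c - (b + d)
    rearrange = solve-∀

  dim≡weightTo : ∀ μ → + dim μ ≡ weightTo (size μ) one μ
  dim≡weightTo μ = trans (count-∑ (isShape μ) (paths (size μ))) (∑-cong (paths (size μ)) isShape≡𝟙)
    where
    isShape≡𝟙 : ∀ p → + isShape μ p ≡ 𝟙 (shape p ≟ₛ μ) * + 1
    isShape≡𝟙 p with shape p ≟ₛ μ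
    ... | yes _ = refl
    ... | no  _ = refl

  charTransp≡weightTo : ∀ μ → charTransp μ ≡ weightTo (size μ) dominoSign μ
  charTransp≡weightTo μ = begin
    + count (λ p → isShape μ p ℕ.* secondRowIs 0 p) P - + count (λ p → isShape μ p ℕ.* secondRowIs 1 p) P
      ≡⟨ cong₂ _-_ (count-∑ _ P) (count-∑ _ P) ⟩
    ∑[ p ∈ P ] (+ (isShape μ p ℕ.* secondRowIs 0 p)) - ∑[ p ∈ P ] (+ (isShape μ p ℕ.* secondRowIs 1 p))
      ≡⟨ ∑-- P _ _ ⟨
    ∑[ p ∈ P ] (+ (isShape μ p ℕ.* secondRowIs 0 p) - + (isShape μ p ℕ.* secondRowIs 1 p))
      ≡⟨ ∑-cong P signed ⟩
    weightTo (size μ) dominoSign μ ∎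
    where
    open ≡-Reasoning
    P = paths (size μ)
    signed : ∀ p → + (isShape μ p ℕ.* secondRowIs 0 p) - + (isShape μ p ℕ.* secondRowIs 1 p) ≡ 𝟙 (shape p ≟ₛ μ) * dominoSign p
    signed p with shape p ≟ₛ μ
    ... | yes _ = trans (cong₂ (λ a b → + a - + b) (ℕP.+-identityʳ (secondRowIs 0 p)) (ℕP.+-identityʳ (secondRowIs 1 p)))
                        (sym (ℤP.*-identityˡ (dominoSign p)))
    ... | no  _ = refl

  count-self : ∀ {B : Set} (g : B → B → ℕ) xs → All (λ x → g x x ℕ.≤ count (g x) xs) xs
  count-self g []       = []
  count-self g (x ∷ xs) = ℕP.m≤m+n (g x x) _ ∷ All.map (λ {y} le → ℕP.≤-trans le (ℕP.m≤n+m _ (g y x))) (count-self g xs)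

  dim-positive : ∀ m → All (λ q → 1 ℕ.≤ dim (shape q)) (paths m)
  dim-positive m = All.zipWith positive (count-self (λ q → isShape (shape q)) (paths m) , paths-wellFormed m)
    where
    isShape-self : ∀ q → isShape (shape q) q ≡ 1
    isShape-self q with shape q ≟ₛ shape q
    ... | yes _  = refl
    ... | no  ≢q = ⊥-elim (≢q refl)
    positive : ∀ {q} → isShape (shape q) q ℕ.≤ count (isShape (shape q)) (paths m) × WellFormed m q → 1 ℕ.≤ dim (shape q)
    positive {q} (le , _ , s , _) rewrite s = subst (ℕ._≤ count (isShape (shape q)) (paths m)) (isShape-self q) le

  2[1+m]∸3 : ∀ m → + m * + (2 ℕ.* suc m ℕ.∸ 3) ≡ + m * (+ 2 * + m - + 1)
  2[1+m]∸3 zero    = refl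
  2[1+m]∸3 (suc m) = cong (+ suc m *_) (begin
    + (2 ℕ.* (2 ℕ.+ m) ℕ.∸ 3)  ≡⟨ cong (λ t → + (t ℕ.∸ 3)) (ℕP.*-distribˡ-+ 2 2 m) ⟩
    + 1 + + (2 ℕ.* m)          ≡⟨ cong (_+_ (+ 1)) (ℤP.pos-* 2 m) ⟩
    + 1 + + 2 * + m            ≡⟨ rearrange (+ m) ⟩
    + 2 * (+ 1 + + m) - + 1    ∎)
    where
    open ≡-Reasoning
    rearrange : ∀ m → + 1 + + 2 * m ≡ + 2 * (+ 1 + m) - + 1
    rearrange = solve-∀

  choose2-double : ∀ m → + 2 * + choose2 m ≡ + m * (+ m - + 1)
  choose2-double zero    = refl
  choose2-double (suc m) = begin
    + 2 * + (suc m C 2)             ≡⟨ cong (λ t → + 2 * + t) (nCk+nC[k+1]≡[n+1]C[k+1] m 1) ⟨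
    + 2 * + (m C 1 ℕ.+ m C 2)       ≡⟨ cong (λ t → + 2 * t) (ℤP.pos-+ (m C 1) (m C 2)) ⟩
    + 2 * (+ (m C 1) + + (m C 2))   ≡⟨ cong (λ t → + 2 * (+ t + + (m C 2))) (nC1≡n m) ⟩
    + 2 * (+ m + + choose2 m)       ≡⟨ ℤP.*-distribˡ-+ (+ 2) (+ m) (+ choose2 m) ⟩
    + 2 * + m + + 2 * + choose2 m   ≡⟨ cong (_+_ (+ 2 * + m)) (choose2-double m) ⟩
    + 2 * + m + + m * (+ m - + 1)   ≡⟨ rearrange (+ m) ⟩
    + suc m * (+ suc m - + 1)       ∎
    where
    open ≡-Reasoning
    rearrange : ∀ m → + 2 * m + m * (m - + 1) ≡ (+ 1 + m) * ((+ 1 + m) - + 1)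
    rearrange = solve-∀

  -- m (m + 1) · ∑ χ((12))² · C(m, 2) = m (m + 1)!, with ∑ χ((12))² = 2 (m − 2)!.
  mixed-count : ∀ k → let m = suc (suc k) in
    + m * + suc m * (+ 2 * + (k !)) * + choose2 m ≡ + m * + (suc m !)
  mixed-count k = begin
    M * (+ 1 + M) * (+ 2 * F) * + choose2 (suc (suc k))  ≡⟨ pull-two M F (+ choose2 (suc (suc k))) ⟩
    M * (+ 1 + M) * F * (+ 2 * + choose2 (suc (suc k)))  ≡⟨ cong (λ t → M * (+ 1 + M) * F * t) (choose2-double (suc (suc k))) ⟩
    M * (+ 1 + M) * F * (M * (M - + 1))                   ≡⟨ regroup (+ k) F ⟩
    M * ((+ 1 + M) * (M * ((+ 1 + + k) * F)))             ≡⟨ cong (M *_) factorial ⟨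
    M * + (suc (suc (suc k)) !)                           ∎
    where
    open ≡-Reasoning
    M = + suc (suc k)
    F = + (k !)
    pull-two : ∀ m f c → m * (+ 1 + m) * (+ 2 * f) * c ≡ m * (+ 1 + m) * f * (+ 2 * c)
    pull-two = solve-∀
    regroup : ∀ k f → (+ 2 + k) * (+ 1 + (+ 2 + k)) * f * ((+ 2 + k) * ((+ 2 + k) - + 1))
                      ≡ (+ 2 + k) * ((+ 1 + (+ 2 + k)) * ((+ 2 + k) * ((+ 1 + k) * f)))
    regroup = solve-∀
    factorial : + (suc (suc (suc k)) !) ≡ + suc (suc (suc k)) * (+ suc (suc k) * (+ suc k * + (k !)))
    factorial = trans (ℤP.pos-* (suc (suc (suc k))) (suc (suc k) !))
      (cong (+ suc (suc (suc k)) *_) (trans (ℤP.pos-* (suc (suc k)) (suc k !)) (cong (+ suc (suc k) *_) (ℤP.pos-* (suc k) (k !)))))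

-- Expectations under the growth process

module _ where

  open import Data.Rational using (_+_; _*_; -_; _≤_; _<_; ∣_∣)
  open ℚΣ

  ringℚ : ACR.AlmostCommutativeRing 0ℓ 0ℓ
  ringℚ = ACR.fromCommutativeRing ℚP.+-*-commutativeRing zero?
    where
    zero? : ∀ x → Maybe (0ℚ ≡ x)
    zero? x with 0ℚ ℚP.≟ x
    ... | yes 0≡x = just 0≡x
    ... | no  _   = nothing

  0≤*  : ∀ {a b} → 0ℚ ≤ a → 0ℚ ≤ b → 0ℚ ≤ a * b
  0≤* {a} {b} 0≤a 0≤b = subst (_≤ a * b) (ℚP.*-zeroʳ a) (ℚP.*-monoˡ-≤-nonNeg a {{ℚ.nonNegative 0≤a}} 0≤b)

  ∣x∣*∣x∣ : ∀ x → ∣ x ∣ * ∣ x ∣ ≡ x * x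
  ∣x∣*∣x∣ x with ℚP.∣p∣≡p∨∣p∣≡-p x
  ... | inj₁ ∣x∣≡x  = cong₂ _*_ ∣x∣≡x ∣x∣≡x
  ... | inj₂ ∣x∣≡-x = trans (cong₂ _*_ ∣x∣≡-x ∣x∣≡-x) (neg-square x)
    where
    neg-square : ∀ x → - x * - x ≡ x * x
    neg-square = solveℚ-∀ ringℚ

  0≤x*x : ∀ x → 0ℚ ≤ x * x
  0≤x*x x = subst (0ℚ ≤_) (∣x∣*∣x∣ x) (0≤* (ℚP.0≤∣p∣ x) (ℚP.0≤∣p∣ x))

  0≤∑ : ∀ {B : Set} (xs : List B) (f : B → ℚ) → (∀ x → 0ℚ ≤ f x) → 0ℚ ≤ ∑ xs f
  0≤∑ []       f 0≤f = ℚP.≤-refl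
  0≤∑ (x ∷ xs) f 0≤f = subst (_≤ f x + ∑ xs f) (ℚP.+-identityʳ 0ℚ) (ℚP.+-mono-≤ (0≤f x) (0≤∑ xs f 0≤f))

  module CauchySchwarz {I : Set} (xs : List I) (w u v : I → ℚ) where

    private
      two = 1ℚ + 1ℚ
      a b c : I → ℚ
      a x = w x * (u x * u x)
      b x = w x * (u x * v x)
      c x = w x * (v x * v x)
      A = ∑ xs a
      B = ∑ xs b
      C = ∑ xs c
      d : I → I → ℚ
      d x y = u x * v y + - (u y * v x)
      S = ∑[ x ∈ xs ] ∑[ y ∈ xs ] (w x * w y * (d x y * d x y))

    lagrange : S + two * (B * B) ≡ two * (A * C)
    lagrange = begin
      S + two * (B * B)
        ≡⟨ cong (λ t → S + two * t) (∑-∑-* xs xs b b) ⟨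
      S + two * ∑[ x ∈ xs ] ∑[ y ∈ xs ] (b x * b y)
        ≡⟨ cong (_+_ S) (trans (sym (∑-*ˡ two xs (λ x → ∑[ y ∈ xs ] (b x * b y))))
                              (∑-cong xs (λ x → sym (∑-*ˡ two xs (λ y → b x * b y))))) ⟩
      S + ∑[ x ∈ xs ] ∑[ y ∈ xs ] (two * (b x * b y))
        ≡⟨ trans (sym (∑-+ xs (λ x → ∑[ y ∈ xs ] (w x * w y * (d x y * d x y))) (λ x → ∑[ y ∈ xs ] (two * (b x * b y)))))
                 (∑-cong xs (λ x → sym (∑-+ xs (λ y → w x * w y * (d x y * d x y)) (λ y → two * (b x * b y))))) ⟩
      ∑[ x ∈ xs ] ∑[ y ∈ xs ] (w x * w y * (d x y * d x y) + two * (b x * b y))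
        ≡⟨ ∑-cong xs (λ x → ∑-cong xs (λ y → pointwise (w x) (w y) (u x) (u y) (v x) (v y))) ⟩
      ∑[ x ∈ xs ] ∑[ y ∈ xs ] (a x * c y + a y * c x)
        ≡⟨ trans (∑-cong xs (λ x → ∑-+ xs (λ y → a x * c y) (λ y → a y * c x)))
                 (∑-+ xs (λ x → ∑[ y ∈ xs ] (a x * c y)) (λ x → ∑[ y ∈ xs ] (a y * c x))) ⟩
      ∑[ x ∈ xs ] ∑[ y ∈ xs ] (a x * c y) + ∑[ x ∈ xs ] ∑[ y ∈ xs ] (a y * c x)
        ≡⟨ cong₂ _+_ (∑-∑-* xs xs a c) (trans (∑-cong xs (λ x → ∑-cong xs (λ y → ℚP.*-comm (a y) (c x)))) (∑-∑-* xs xs c a)) ⟩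
      A * C + C * A
        ≡⟨ double A C ⟩
      two * (A * C) ∎
      where
      open ≡-Reasoning
      pointwise : ∀ wx wy ux uy vx vy →
        wx * wy * ((ux * vy + - (uy * vx)) * (ux * vy + - (uy * vx))) + (1ℚ + 1ℚ) * ((wx * (ux * vx)) * (wy * (uy * vy)))
        ≡ (wx * (ux * ux)) * (wy * (vy * vy)) + (wy * (uy * uy)) * (wx * (vx * vx))
      pointwise = solveℚ-∀ ringℚ
      double : ∀ A C → A * C + C * A ≡ (1ℚ + 1ℚ) * (A * C)
      double = solveℚ-∀ ringℚ

    cauchy-schwarz : (∀ x → 0ℚ ≤ w x) → B * B ≤ A * C
    cauchy-schwarz 0≤w = ℚP.*-cancelˡ-≤-pos two {{ℚ.positive (ℚP.positive⁻¹ two)}} (begin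
      two * (B * B)       ≡⟨ ℚP.+-identityˡ _ ⟨
      0ℚ + two * (B * B)  ≤⟨ ℚP.+-monoˡ-≤ (two * (B * B)) 0≤S ⟩
      S + two * (B * B)   ≡⟨ lagrange ⟩
      two * (A * C)       ∎)
      where
      open ℚP.≤-Reasoning
      0≤S : 0ℚ ≤ S
      0≤S = 0≤∑ xs _ (λ x → 0≤∑ xs _ (λ y → 0≤* (0≤* (0≤w x) (0≤w y)) (0≤x*x (d x y))))

  sumℚ≡∑ : ∀ {B : Set} (f : B → ℚ) xs → sumℚ f xs ≡ ∑ xs f
  sumℚ≡∑ f []       = refl
  sumℚ≡∑ f (x ∷ xs) = cong (_+_ (f x)) (sumℚ≡∑ f xs)

  private
    toℚᵘ-fromℤ : ∀ z → ℚ.toℚᵘ (fromℤ z) ℚᵘ.≃ mkℚᵘ z 0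
    toℚᵘ-fromℤ z = ℚP.toℚᵘ-fromℚᵘ (mkℚᵘ z 0)

  fromℤ-+ : ∀ a b → fromℤ (a ℤ.+ b) ≡ fromℤ a + fromℤ b
  fromℤ-+ a b = ℚP.toℚᵘ-injective (begin-equality
    ℚ.toℚᵘ (fromℤ (a ℤ.+ b))              ≃⟨ toℚᵘ-fromℤ (a ℤ.+ b) ⟩
    mkℚᵘ (a ℤ.+ b) 0                      ≃⟨ *≡* (sum-over-1 a b) ⟩
    mkℚᵘ a 0 ℚᵘ.+ mkℚᵘ b 0                ≃⟨ ℚᵘP.+-cong (toℚᵘ-fromℤ a) (toℚᵘ-fromℤ b) ⟨
    ℚ.toℚᵘ (fromℤ a) ℚᵘ.+ ℚ.toℚᵘ (fromℤ b) ≃⟨ ℚP.toℚᵘ-homo-+ (fromℤ a) (fromℤ b) ⟨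
    ℚ.toℚᵘ (fromℤ a + fromℤ b)            ∎)
    where
    open ℚᵘP.≤-Reasoning
    sum-over-1 : ∀ a b → (a ℤ.+ b) ℤ.* + 1 ≡ (a ℤ.* + 1 ℤ.+ b ℤ.* + 1) ℤ.* + 1
    sum-over-1 = solve-∀

  fromℤ-* : ∀ a b → fromℤ (a ℤ.* b) ≡ fromℤ a * fromℤ b
  fromℤ-* a b = ℚP.toℚᵘ-injective (begin-equality
    ℚ.toℚᵘ (fromℤ (a ℤ.* b))              ≃⟨ toℚᵘ-fromℤ (a ℤ.* b) ⟩
    mkℚᵘ (a ℤ.* b) 0                      ≃⟨ ℚᵘP.*-cong (toℚᵘ-fromℤ a) (toℚᵘ-fromℤ b) ⟨
    ℚ.toℚᵘ (fromℤ a) ℚᵘ.* ℚ.toℚᵘ (fromℤ b) ≃⟨ ℚP.toℚᵘ-homo-* (fromℤ a) (fromℤ b) ⟨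
    ℚ.toℚᵘ (fromℤ a * fromℤ b)            ∎)
    where open ℚᵘP.≤-Reasoning

  fromℤ-mono : ∀ {a b} → a ℤ.≤ b → fromℤ a ≤ fromℤ b
  fromℤ-mono {a} {b} a≤b = ℚP.toℚᵘ-cancel-≤ (begin
    ℚ.toℚᵘ (fromℤ a) ≃⟨ toℚᵘ-fromℤ a ⟩
    mkℚᵘ a 0         ≤⟨ *≤* (ℤP.*-monoʳ-≤-nonNeg (+ 1) a≤b) ⟩
    mkℚᵘ b 0         ≃⟨ toℚᵘ-fromℤ b ⟨
    ℚ.toℚᵘ (fromℤ b) ∎)
    where open ℚᵘP.≤-Reasoning

  fromℤ-∑ : ∀ {B : Set} xs (f : B → ℤ) → fromℤ (ℤΣ.∑ xs f) ≡ ∑[ x ∈ xs ] fromℤ (f x)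
  fromℤ-∑ []       f = refl
  fromℤ-∑ (x ∷ xs) f = trans (fromℤ-+ (f x) _) (cong (_+_ (fromℤ (f x))) (fromℤ-∑ xs f))

  fromℤ-𝟙 : ∀ {P : Set} (d : Dec P) → fromℤ (ℤΣ.𝟙 d) ≡ 𝟙 d
  fromℤ-𝟙 (yes _) = refl
  fromℤ-𝟙 (no _)  = refl

  fromℕ-* : ∀ a b → fromℕ (a ℕ.* b) ≡ fromℕ a * fromℕ b
  fromℕ-* a b = trans (cong fromℤ (ℤP.pos-* a b)) (fromℤ-* (+ a) (+ b))

  0<fromℕ : ∀ {n} → 1 ℕ.≤ n → 0ℚ < fromℕ n
  0<fromℕ {suc n} _ = ℚP.positive⁻¹ _ {{ℚP.normalize-pos (suc n) 1}}

  /′-*-cancel : ∀ z {n} → 1 ℕ.≤ n → (z /' n) * fromℕ n ≡ fromℤ z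
  /′-*-cancel z {suc n} _ = ℚP.toℚᵘ-injective (begin-equality
    ℚ.toℚᵘ ((z ℚ./ suc n) * fromℕ (suc n))                  ≃⟨ ℚP.toℚᵘ-homo-* (z ℚ./ suc n) (fromℕ (suc n)) ⟩
    ℚ.toℚᵘ (z ℚ./ suc n) ℚᵘ.* ℚ.toℚᵘ (fromℕ (suc n))       ≃⟨ ℚᵘP.*-cong (ℚP.toℚᵘ-fromℚᵘ (mkℚᵘ z n)) (toℚᵘ-fromℤ (+ suc n)) ⟩
    mkℚᵘ z n ℚᵘ.* mkℚᵘ (+ suc n) 0                         ≃⟨ *≡* (trans (cancel z (+ suc n)) (cong (λ d → z ℤ.* + d) (sym (ℕP.*-identityʳ (suc n))))) ⟩
    mkℚᵘ z 0                                               ≃⟨ toℚᵘ-fromℤ z ⟨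
    ℚ.toℚᵘ (fromℤ z)                                       ∎)
    where
    open ℚᵘP.≤-Reasoning
    cancel : ∀ z s → z ℤ.* s ℤ.* + 1 ≡ z ℤ.* s
    cancel = solve-∀

  prob-dim : ∀ m → All (λ p → prob p * fromℕ (suc m !) ≡ fromℕ (dim (shape p))) (paths (suc m))
  prob-dim zero    = refl ∷ []
  prob-dim (suc m) =
    AllP.concat⁺ (AllP.map⁺ (All.map extend (All.zip (prob-dim m , All.zip (paths-wellFormed (suc m) , dim-positive (suc m))))))
    where
    step : ∀ r q → length q ≡ suc m → prob q * fromℕ (suc m !) ≡ fromℕ (dim (shape q)) → 1 ℕ.≤ dim (shape q) →
           prob (r ∷ q) * fromℕ (suc (suc m) !) ≡ fromℕ (dim (shape (r ∷ q)))
    step r q@(_ ∷ _) len ih 1≤dim = begin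
      T * prob q * fromℕ (suc (suc m) !)                  ≡⟨ cong (T * prob q *_) (fromℕ-* (suc (suc m)) (suc m !)) ⟩
      T * prob q * (fromℕ (suc (suc m)) * fromℕ (suc m !)) ≡⟨ rearrange T (prob q) (fromℕ (suc (suc m))) (fromℕ (suc m !)) ⟩
      T * (fromℕ (suc (suc m)) * (prob q * fromℕ (suc m !))) ≡⟨ cong (λ t → T * (fromℕ (suc (suc m)) * t)) ih ⟩
      T * (fromℕ (suc (suc m)) * fromℕ (dim (shape q)))   ≡⟨ cong (T *_) (fromℕ-* (suc (suc m)) (dim (shape q))) ⟨
      T * fromℕ (suc (suc m) ℕ.* dim (shape q))           ≡⟨ cong (λ l → T * fromℕ (suc l ℕ.* dim (shape q))) len ⟨
      T * fromℕ (suc (length q) ℕ.* dim (shape q))        ≡⟨ /′-*-cancel (+ dim (shape (r ∷ q))) (ℕP.*-mono-≤ {1} {suc (length q)} (s≤s z≤n) 1≤dim) ⟩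
      fromℕ (dim (shape (r ∷ q)))                         ∎
      where
      open ≡-Reasoning
      T = transition (length q) (shape q) (shape (r ∷ q))
      rearrange : ∀ t p a b → t * p * (a * b) ≡ t * (a * (p * b))
      rearrange = solveℚ-∀ ringℚ
    extend : ∀ {q} → (prob q * fromℕ (suc m !) ≡ fromℕ (dim (shape q))) × WellFormed (suc m) q × 1 ℕ.≤ dim (shape q) →
             All (λ p → prob p * fromℕ (suc (suc m) !) ≡ fromℕ (dim (shape p))) (map (_∷ q) (addable (shape q)))
    extend {q} (ih , (_ , _ , len) , 1≤dim) = AllP.map⁺ (All.universal (λ r → step r q len ih 1≤dim) _)

  0≤1ℚ : 0ℚ ≤ 1ℚ
  0≤1ℚ = ℚP.<⇒≤ (ℚP.positive⁻¹ 1ℚ)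

  0≤fromℕ : ∀ n → 0ℚ ≤ fromℕ n
  0≤fromℕ n = fromℤ-mono {+ 0} {+ n} (ℤ.+≤+ z≤n)

  0≤prob : ∀ p → 0ℚ ≤ prob p
  0≤prob []          = 0≤1ℚ
  0≤prob (r ∷ [])    = 0≤1ℚ
  0≤prob (r ∷ q@(_ ∷ _)) = 0≤* (0≤/′ (dim (shape (r ∷ q))) (suc (length q) ℕ.* dim (shape q))) (0≤prob q)
    where
    0≤/′ : ∀ a d → 0ℚ ≤ + a /' d
    0≤/′ a zero    = ℚP.≤-refl
    0≤/′ a (suc d) = ℚP.nonNegative⁻¹ _ {{ℚP.normalize-nonNeg a (suc d)}}

  E-scaled : ∀ m (F : Path → ℚ) → E (suc m) F * fromℕ (suc m !) ≡ ∑[ p ∈ paths (suc m) ] (fromℕ (dim (shape p)) * F p)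
  E-scaled m F = begin
    E (suc m) F * fromℕ (suc m !)                             ≡⟨ cong (_* fromℕ (suc m !)) (sumℚ≡∑ _ (paths (suc m))) ⟩
    ∑[ p ∈ paths (suc m) ] (prob p * F p) * fromℕ (suc m !)   ≡⟨ ∑-*ʳ (fromℕ (suc m !)) (paths (suc m)) (λ p → prob p * F p) ⟨
    ∑[ p ∈ paths (suc m) ] (prob p * F p * fromℕ (suc m !))   ≡⟨ ∑-congᴬ (prob-dim m) (λ p eq → trans (rearrange (prob p) (F p) _) (cong (_* F p) eq)) ⟩
    ∑[ p ∈ paths (suc m) ] (fromℕ (dim (shape p)) * F p)      ∎
    where
    open ≡-Reasoning
    rearrange : ∀ p f n → p * f * n ≡ p * n * f
    rearrange = solveℚ-∀ ringℚ

  E-transitionSum : ∀ m (Φ : Shape → ℚ) (f : ℤ → ℤ) →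
    E (suc m) (λ p → Φ (prevShape p) * fromℤ (f (X p))) * fromℕ (suc m !)
    ≡ ∑[ q ∈ paths m ] (Φ (shape q) * fromℤ (transitionSum (suc m) m one f (shape q)))
  E-transitionSum m Φ f = begin
    E (suc m) (λ p → Φ (prevShape p) * fromℤ (f (X p))) * fromℕ (suc m !)
      ≡⟨ E-scaled m _ ⟩
    ∑[ p ∈ paths (suc m) ] (fromℕ (dim (shape p)) * (Φ (prevShape p) * fromℤ (f (X p))))
      ≡⟨ ∑-concatMap (λ q → map (_∷ q) (addable (shape q))) (paths m) _ ⟩
    ∑[ q ∈ paths m ] ∑ (map (_∷ q) (addable (shape q))) (λ p → fromℕ (dim (shape p)) * (Φ (prevShape p) * fromℤ (f (X p))))
      ≡⟨ ∑-congᴬ (paths-wellFormed m) (λ q wf → trans (∑-map (_∷ q) (addable (shape q)) _) (extend q wf)) ⟩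
    ∑[ q ∈ paths m ] (Φ (shape q) * fromℤ (transitionSum (suc m) m one f (shape q))) ∎
    where
    open ≡-Reasoning
    extend : ∀ q → WellFormed m q →
      ∑[ r ∈ addable (shape q) ] (fromℕ (dim (addBox r (shape q))) * (Φ (shape q) * fromℤ (f (content r (shape q)))))
      ≡ Φ (shape q) * fromℤ (transitionSum (suc m) m one f (shape q))
    extend q wf@(pκ , sκ , _) = begin
      ∑[ r ∈ addable κ ] (fromℕ (dim (addBox r κ)) * (Φ κ * fromℤ (f (content r κ))))
        ≡⟨ ∑-cong (addable κ) (λ r → trans (rearrange (fromℕ (dim (addBox r κ))) (Φ κ) (fromℤ (f (content r κ))))
                                           (cong (Φ κ *_) (sym (fromℤ-* (f (content r κ)) (+ dim (addBox r κ)))))) ⟩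
      ∑[ r ∈ addable κ ] (Φ κ * fromℤ (f (content r κ) ℤ.* + dim (addBox r κ)))
        ≡⟨ ∑-*ˡ (Φ κ) (addable κ) _ ⟩
      Φ κ * ∑[ r ∈ addable κ ] fromℤ (f (content r κ) ℤ.* + dim (addBox r κ))
        ≡⟨ cong (Φ κ *_) (fromℤ-∑ (addable κ) (λ r → f (content r κ) ℤ.* + dim (addBox r κ))) ⟨
      Φ κ * fromℤ (ℤΣ.∑ (addable κ) (λ r → f (content r κ) ℤ.* + dim (addBox r κ)))
        ≡⟨ cong (λ z → Φ κ * fromℤ z) (trans (∑-addable κ _ (suc m) (wellFormed⇒length< {q = q} wf ℕP.≤-refl))
             (ℤΣ.∑<∣-cong (λ r → addable? r κ) (suc m) (λ r a → cong (f (content r κ) ℤ.*_) (dim-addBox r a)))) ⟩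
      Φ κ * fromℤ (transitionSum (suc m) m one f κ) ∎
      where
      κ = shape q
      rearrange : ∀ d φ x → d * (φ * x) ≡ φ * (x * d)
      rearrange = solveℚ-∀ ringℚ
      dim-addBox : ∀ r → Addable r κ → + dim (addBox r κ) ≡ weightTo (suc m) one (addBox r κ)
      dim-addBox r a = trans (dim≡weightTo (addBox r κ))
        (cong (λ n → weightTo n one (addBox r κ)) (trans (size-addBox r κ (addable⇒≤length r a)) (cong suc sκ)))

  E-cong : ∀ n {F G : Path → ℚ} → (∀ p → F p ≡ G p) → E n F ≡ E n G
  E-cong n F≗G = trans (sumℚ≡∑ _ (paths n)) (trans (∑-cong (paths n) (λ p → cong (prob p *_) (F≗G p))) (sym (sumℚ≡∑ _ (paths n))))

  0≤E : ∀ n F → (∀ p → 0ℚ ≤ F p) → 0ℚ ≤ E n F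
  0≤E n F 0≤F = subst (0ℚ ≤_) (sym (sumℚ≡∑ _ (paths n))) (0≤∑ (paths n) _ (λ p → 0≤* (0≤prob p) (0≤F p)))

  E-cauchy-schwarz : ∀ n (u v : Path → ℚ) →
    E n (λ p → u p * v p) * E n (λ p → u p * v p) ≤ E n (λ p → u p * u p) * E n (λ p → v p * v p)
  E-cauchy-schwarz n u v = subst₂ _≤_ (sym (cong₂ _*_ (sumℚ≡∑ _ (paths n)) (sumℚ≡∑ _ (paths n))))
                                      (sym (cong₂ _*_ (sumℚ≡∑ _ (paths n)) (sumℚ≡∑ _ (paths n))))
                                      (CauchySchwarz.cauchy-schwarz (paths n) prob u v 0≤prob)

  factorial-cancel : ∀ m {x y} → x * fromℕ (suc m !) ≡ y * fromℕ (suc m !) → x ≡ y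
  factorial-cancel m eq = ℚP.≤-antisym (cancel (ℚP.≤-reflexive eq)) (cancel (ℚP.≤-reflexive (sym eq)))
    where
    cancel : ∀ {x y} → x * fromℕ (suc m !) ≤ y * fromℕ (suc m !) → x ≤ y
    cancel = ℚP.*-cancelʳ-≤-pos (fromℕ (suc m !)) {{ℚ.positive (0<fromℕ (ℕP.1≤n! (suc m)))}}

  ∑-fromℤ : ∀ {B : Set} xs (g : B → ℤ) → ∑[ x ∈ xs ] (1ℚ * fromℤ (g x)) ≡ fromℤ (ℤΣ.∑ xs g)
  ∑-fromℤ xs g = trans (∑-cong xs (λ x → ℚP.*-identityˡ _)) (sym (fromℤ-∑ xs g))

  square-moment : ∀ m → E (suc m) (λ p → fromℤ (X p) * fromℤ (X p)) ≡ fromℕ m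
  square-moment m = factorial-cancel m (begin
    E (suc m) (λ p → fromℤ (X p) * fromℤ (X p)) * N
      ≡⟨ cong (_* N) (E-cong (suc m) (λ p → trans (sym (fromℤ-* (X p) (X p))) (sym (ℚP.*-identityˡ _)))) ⟩
    E (suc m) (λ p → 1ℚ * fromℤ (square (X p))) * N
      ≡⟨ E-transitionSum m (λ _ → 1ℚ) square ⟩
    ∑[ q ∈ paths m ] (1ℚ * fromℤ (transitionSum (suc m) m one square (shape q)))
      ≡⟨ ∑-fromℤ (paths m) _ ⟩
    fromℤ (ℤΣ.∑ (paths m) (λ q → transitionSum (suc m) m one square (shape q)))
      ≡⟨ cong fromℤ (ℤΣ.∑-congᴬ (paths-wellFormed m) (λ q (p , s , _) → transitionSum-square m (suc m) p s ℕP.≤-refl)) ⟩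
    fromℤ (ℤΣ.∑ (paths m) (λ q → + m ℤ.* + suc m ℤ.* weightTo m one (shape q)))
      ≡⟨ cong fromℤ (trans (ℤΣ.∑-*ˡ (+ m ℤ.* + suc m) (paths m) _) (cong (+ m ℤ.* + suc m ℤ.*_) (∑paths-dim m))) ⟩
    fromℤ (+ m ℤ.* + suc m ℤ.* + (m !))
      ≡⟨ cong fromℤ (trans (ℤP.*-assoc (+ m) (+ suc m) (+ (m !))) (cong (+ m ℤ.*_) (sym (ℤP.pos-* (suc m) (m !))))) ⟩
    fromℤ (+ m ℤ.* + (suc m !))
      ≡⟨ fromℤ-* (+ m) (+ (suc m !)) ⟩
    fromℕ m * N ∎)
    where
    open ≡-Reasoning
    N = fromℕ (suc m !)

  fourth-moment : ∀ m → E (suc m) (λ p → (fromℤ (X p) * fromℤ (X p)) * (fromℤ (X p) * fromℤ (X p)))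
                        ≡ fromℕ m * fromℕ (2 ℕ.* suc m ℕ.∸ 3)
  fourth-moment m = factorial-cancel m (begin
    E (suc m) (λ p → (fromℤ (X p) * fromℤ (X p)) * (fromℤ (X p) * fromℤ (X p))) * N
      ≡⟨ cong (_* N) (E-cong (suc m) (λ p → trans (sym (fromℤ-fourth (X p))) (sym (ℚP.*-identityˡ _)))) ⟩
    E (suc m) (λ p → 1ℚ * fromℤ (fourth (X p))) * N
      ≡⟨ E-transitionSum m (λ _ → 1ℚ) fourth ⟩
    ∑[ q ∈ paths m ] (1ℚ * fromℤ (transitionSum (suc m) m one fourth (shape q)))
      ≡⟨ ∑-fromℤ (paths m) _ ⟩
    fromℤ (plancherel-fourth (suc m) m)
      ≡⟨ cong fromℤ (plancherel-fourth-closed m (suc m) ℕP.≤-refl) ⟩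
    fromℤ (+ (suc m !) ℤ.* + m ℤ.* (+ 2 ℤ.* + m ℤ.- + 1))
      ≡⟨ cong fromℤ (trans (ℤP.*-assoc (+ (suc m !)) (+ m) _) (trans (cong (+ (suc m !) ℤ.*_) (sym (2[1+m]∸3 m))) (ℤP.*-comm (+ (suc m !)) _))) ⟩
    fromℤ (+ m ℤ.* + (2 ℕ.* suc m ℕ.∸ 3) ℤ.* + (suc m !))
      ≡⟨ trans (fromℤ-* (+ m ℤ.* + (2 ℕ.* suc m ℕ.∸ 3)) (+ (suc m !))) (cong (_* N) (fromℤ-* (+ m) (+ (2 ℕ.* suc m ℕ.∸ 3)))) ⟩
    fromℕ m * fromℕ (2 ℕ.* suc m ℕ.∸ 3) * N ∎)
    where
    open ≡-Reasoning
    N = fromℕ (suc m !)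
    fromℤ-fourth : ∀ z → fromℤ (fourth z) ≡ (fromℤ z * fromℤ z) * (fromℤ z * fromℤ z)
    fromℤ-fourth z = trans (fromℤ-* (square z) (square z)) (cong₂ _*_ (fromℤ-* z z) (fromℤ-* z z))

  ∑paths-reweight : ∀ m (Ψ : Shape → ℚ) (a : Path → ℤ) →
    ∑[ q ∈ paths m ] (Ψ (shape q) * fromℤ (weightTo m a (shape q)))
    ≡ ∑[ q ∈ paths m ] (fromℤ (a q) * (Ψ (shape q) * fromℤ (weightTo m one (shape q))))
  ∑paths-reweight m Ψ a = begin
    ∑[ q ∈ P ] (Ψ (shape q) * fromℤ (weightTo m a (shape q)))
      ≡⟨ ∑-cong P (λ q → trans (cong (Ψ (shape q) *_) (fromℤ-∑ P _)) (sym (∑-*ˡ (Ψ (shape q)) P _))) ⟩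
    ∑[ q ∈ P ] ∑[ q′ ∈ P ] (Ψ (shape q) * fromℤ (ℤΣ.𝟙 (shape q′ ≟ₛ shape q) ℤ.* a q′))
      ≡⟨ ∑-comm P P _ ⟩
    ∑[ q′ ∈ P ] ∑[ q ∈ P ] (Ψ (shape q) * fromℤ (ℤΣ.𝟙 (shape q′ ≟ₛ shape q) ℤ.* a q′))
      ≡⟨ ∑-cong P (λ q′ → ∑-cong P (λ q → pointwise q′ q)) ⟩
    ∑[ q′ ∈ P ] ∑[ q ∈ P ] (fromℤ (a q′) * (Ψ (shape q′) * fromℤ (ℤΣ.𝟙 (shape q ≟ₛ shape q′) ℤ.* one q)))
      ≡⟨ ∑-cong P (λ q′ → trans (∑-*ˡ (fromℤ (a q′)) P _) (cong (fromℤ (a q′) *_)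
           (trans (∑-*ˡ (Ψ (shape q′)) P _) (cong (Ψ (shape q′) *_) (sym (fromℤ-∑ P _)))))) ⟩
    ∑[ q′ ∈ P ] (fromℤ (a q′) * (Ψ (shape q′) * fromℤ (weightTo m one (shape q′)))) ∎
    where
    open ≡-Reasoning
    P = paths m
    pointwise : ∀ q′ q → Ψ (shape q) * fromℤ (ℤΣ.𝟙 (shape q′ ≟ₛ shape q) ℤ.* a q′)
                         ≡ fromℤ (a q′) * (Ψ (shape q′) * fromℤ (ℤΣ.𝟙 (shape q ≟ₛ shape q′) ℤ.* one q))
    pointwise q′ q = begin
      Ψ (shape q) * fromℤ (ℤΣ.𝟙 e ℤ.* a q′)        ≡⟨ cong (Ψ (shape q) *_) (trans (fromℤ-* (ℤΣ.𝟙 e) (a q′)) (cong (_* fromℤ (a q′)) (fromℤ-𝟙 e))) ⟩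
      Ψ (shape q) * (𝟙 e * fromℤ (a q′))           ≡⟨ rearrange (Ψ (shape q)) (𝟙 e) (fromℤ (a q′)) ⟩
      fromℤ (a q′) * (𝟙 e * Ψ (shape q))           ≡⟨ cong (fromℤ (a q′) *_) (𝟙-*-cong e (cong Ψ ∘ sym)) ⟩
      fromℤ (a q′) * (𝟙 e * Ψ (shape q′))          ≡⟨ cong (fromℤ (a q′) *_) (indicator-last (𝟙 e) (Ψ (shape q′))) ⟩
      fromℤ (a q′) * (Ψ (shape q′) * (𝟙 e * 1ℚ))   ≡⟨ cong (λ t → fromℤ (a q′) * (Ψ (shape q′) * (t * 1ℚ))) (𝟙-⇔ e e′ sym sym) ⟩
      fromℤ (a q′) * (Ψ (shape q′) * (𝟙 e′ * 1ℚ))  ≡⟨ cong (λ t → fromℤ (a q′) * (Ψ (shape q′) * (t * 1ℚ))) (fromℤ-𝟙 e′) ⟨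
      fromℤ (a q′) * (Ψ (shape q′) * (fromℤ (ℤΣ.𝟙 e′) * fromℤ (+ 1)))
        ≡⟨ cong (λ t → fromℤ (a q′) * (Ψ (shape q′) * t)) (fromℤ-* (ℤΣ.𝟙 e′) (+ 1)) ⟨
      fromℤ (a q′) * (Ψ (shape q′) * fromℤ (ℤΣ.𝟙 e′ ℤ.* one q)) ∎
      where
      e = shape q′ ≟ₛ shape q
      e′ = shape q ≟ₛ shape q′
      rearrange : ∀ ψ i x → ψ * (i * x) ≡ x * (i * ψ)
      rearrange = solveℚ-∀ ringℚ
      indicator-last : ∀ i ψ → i * ψ ≡ ψ * (i * 1ℚ)
      indicator-last = solveℚ-∀ ringℚ

  charRatio : Shape → ℚ
  charRatio μ = charTransp μ /' dim μ

  charRatio-dim : ∀ m q → WellFormed m q → 1 ℕ.≤ dim (shape q) →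
    charRatio (shape q) * fromℤ (weightTo m one (shape q)) ≡ fromℤ (weightTo m dominoSign (shape q))
  charRatio-dim m q (_ , s , _) 1≤dim = begin
    charRatio (shape q) * fromℤ (weightTo m one (shape q))
      ≡⟨ cong (λ n → charRatio (shape q) * fromℤ (weightTo n one (shape q))) s ⟨
    charRatio (shape q) * fromℤ (weightTo (size (shape q)) one (shape q))
      ≡⟨ cong (λ z → charRatio (shape q) * fromℤ z) (dim≡weightTo (shape q)) ⟨
    charRatio (shape q) * fromℕ (dim (shape q))
      ≡⟨ /′-*-cancel (charTransp (shape q)) 1≤dim ⟩
    fromℤ (charTransp (shape q))
      ≡⟨ cong fromℤ (trans (charTransp≡weightTo (shape q)) (cong (λ n → weightTo n dominoSign (shape q)) s)) ⟩
    fromℤ (weightTo m dominoSign (shape q)) ∎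
    where open ≡-Reasoning

  charRatio²-transitionSum-square : ∀ m q → WellFormed m q × 1 ℕ.≤ dim (shape q) →
    charRatio (shape q) * charRatio (shape q) * fromℤ (transitionSum (suc m) m one square (shape q))
    ≡ fromℤ (+ m ℤ.* + suc m) * (charRatio (shape q) * fromℤ (weightTo m dominoSign (shape q)))
  charRatio²-transitionSum-square m q (wf@(p , s , _) , 1≤dim) = begin
    ρ * ρ * fromℤ (transitionSum (suc m) m one square (shape q))   ≡⟨ cong (λ z → ρ * ρ * fromℤ z) (transitionSum-square m (suc m) p s ℕP.≤-refl) ⟩
    ρ * ρ * fromℤ (K ℤ.* G)                                ≡⟨ cong (ρ * ρ *_) (fromℤ-* K G) ⟩
    ρ * ρ * (fromℤ K * fromℤ G)                            ≡⟨ regroup ρ (fromℤ K) (fromℤ G) ⟩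
    fromℤ K * (ρ * (ρ * fromℤ G))                          ≡⟨ cong (λ t → fromℤ K * (ρ * t)) (charRatio-dim m q wf 1≤dim) ⟩
    fromℤ K * (ρ * fromℤ (weightTo m dominoSign (shape q))) ∎
    where
    open ≡-Reasoning
    ρ = charRatio (shape q)
    K = + m ℤ.* (+ suc m)
    G = weightTo m one (shape q)
    regroup : ∀ ρ k g → ρ * ρ * (k * g) ≡ k * (ρ * (ρ * g))
    regroup = solveℚ-∀ ringℚ

  mixed-moment-scaled : ∀ k → let m = suc (suc k) in
    E (suc m) (λ p → (normChar p * normChar p) * (fromℤ (X p) * fromℤ (X p))) * fromℕ (suc m !)
    ≡ fromℤ (+ m ℤ.* (+ suc m) ℤ.* (+ 2 ℤ.* (+ (k !))))
  mixed-moment-scaled k = begin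
    E (suc m) (λ p → (normChar p * normChar p) * (fromℤ (X p) * fromℤ (X p))) * N
      ≡⟨ cong (_* N) (E-cong (suc m) (λ p → cong (normChar p * normChar p *_) (sym (fromℤ-* (X p) (X p))))) ⟩
    E (suc m) (λ p → (charRatio (prevShape p) * charRatio (prevShape p)) * fromℤ (square (X p))) * N
      ≡⟨ E-transitionSum m (λ μ → charRatio μ * charRatio μ) square ⟩
    ∑[ q ∈ P ] (charRatio (shape q) * charRatio (shape q) * fromℤ (transitionSum (suc m) m one square (shape q)))
      ≡⟨ ∑-congᴬ (All.zip (paths-wellFormed m , dim-positive m)) (charRatio²-transitionSum-square m) ⟩
    ∑[ q ∈ P ] (fromℤ K * (charRatio (shape q) * fromℤ (weightTo m dominoSign (shape q))))
      ≡⟨ ∑-*ˡ (fromℤ K) P (λ q → charRatio (shape q) * fromℤ (weightTo m dominoSign (shape q))) ⟩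
    fromℤ K * ∑[ q ∈ P ] (charRatio (shape q) * fromℤ (weightTo m dominoSign (shape q)))
      ≡⟨ cong (fromℤ K *_) (∑paths-reweight m charRatio dominoSign) ⟩
    fromℤ K * ∑[ q ∈ P ] (fromℤ (dominoSign q) * (charRatio (shape q) * fromℤ (weightTo m one (shape q))))
      ≡⟨ cong (fromℤ K *_) (∑-congᴬ (All.zip (paths-wellFormed m , dim-positive m)) (λ q (wf , 1≤dim) →
           trans (cong (fromℤ (dominoSign q) *_) (charRatio-dim m q wf 1≤dim)) (sym (fromℤ-* (dominoSign q) (weightTo m dominoSign (shape q)))))) ⟩
    fromℤ K * ∑[ q ∈ P ] fromℤ (dominoSign q ℤ.* weightTo m dominoSign (shape q))
      ≡⟨ cong (fromℤ K *_) (trans (sym (fromℤ-∑ P (λ q → dominoSign q ℤ.* weightTo m dominoSign (shape q)))) (cong fromℤ (plancherel-sign-closed k))) ⟩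
    fromℤ K * fromℤ (+ 2 ℤ.* (+ (k !)))
      ≡⟨ fromℤ-* K (+ 2 ℤ.* (+ (k !))) ⟨
    fromℤ (K ℤ.* (+ 2 ℤ.* (+ (k !)))) ∎
    where
    open ≡-Reasoning
    m = suc (suc k)
    N = fromℕ (suc m !)
    P = paths m
    K = + m ℤ.* (+ suc m)

  mixed-moment : ∀ k → let m = suc (suc k) in
    E (suc m) (λ p → (normChar p * normChar p) * (fromℤ (X p) * fromℤ (X p))) * fromℕ (choose2 m) ≡ fromℕ m
  mixed-moment k = factorial-cancel m (begin
    E (suc m) F * B₂ * N                                        ≡⟨ swap-last (E (suc m) F) B₂ N ⟩
    E (suc m) F * N * B₂                                        ≡⟨ cong (_* B₂) (mixed-moment-scaled k) ⟩
    fromℤ (K ℤ.* (+ 2 ℤ.* (+ (k !)))) * B₂                      ≡⟨ fromℤ-* (K ℤ.* (+ 2 ℤ.* (+ (k !)))) (+ choose2 m) ⟨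
    fromℤ (K ℤ.* (+ 2 ℤ.* (+ (k !))) ℤ.* (+ choose2 m))         ≡⟨ cong fromℤ (mixed-count k) ⟩
    fromℤ (+ m ℤ.* (+ (suc m !)))                               ≡⟨ fromℤ-* (+ m) (+ (suc m !)) ⟩
    fromℕ m * N                                                 ∎)
    where
    open ≡-Reasoning
    m = suc (suc k)
    N = fromℕ (suc m !)
    B₂ = fromℕ (choose2 m)
    K = + m ℤ.* (+ suc m)
    F : Path → ℚ
    F p = (normChar p * normChar p) * (fromℤ (X p) * fromℤ (X p))
    swap-last : ∀ e c n → e * c * n ≡ e * n * c
    swap-last = solveℚ-∀ ringℚ

  leSqrt-by-cauchy-schwarz : ∀ n (g u v : Path → ℚ) {b c d} → (∀ p → g p ≡ u p * v p) → (∀ p → 0ℚ ≤ g p) →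
    0ℚ ≤ b → 0ℚ ≤ c → E n (λ p → u p * u p) * b * E n (λ p → v p * v p) ≡ c * c * d → LeSqrt (E n g) b c d
  leSqrt-by-cauchy-schwarz n g u v {b} {c} {d} g≗uv 0≤g 0≤b 0≤c bound = inj₂ (inj₁ (0≤E n g 0≤g , 0≤c , (begin
    E n g * E n g * b            ≡⟨ cong (λ e → e * e * b) (E-cong n g≗uv) ⟩
    E n uv * E n uv * b          ≤⟨ ℚP.*-monoʳ-≤-nonNeg b {{ℚ.nonNegative 0≤b}} (E-cauchy-schwarz n u v) ⟩
    E n uu * E n vv * b          ≡⟨ swap-last (E n uu) (E n vv) b ⟩
    E n uu * b * E n vv          ≡⟨ bound ⟩
    c * c * d                    ∎)))
    where
    open ℚP.≤-Reasoning
    uv uu vv : Path → ℚ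
    uv p = u p * v p
    uu p = u p * u p
    vv p = v p * v p
    swap-last : ∀ e f b → e * f * b ≡ e * b * f
    swap-last = solveℚ-∀ ringℚ

  cube-∣∣ : ∀ z → cube ∣ z ∣ ≡ ∣ z ∣ * (z * z)
  cube-∣∣ z = trans (ℚP.*-comm (∣ z ∣ * ∣ z ∣) (∣ z ∣)) (cong (∣ z ∣ *_) (∣x∣*∣x∣ z))

  0≤cube-∣∣ : ∀ z → 0ℚ ≤ cube ∣ z ∣
  0≤cube-∣∣ z = subst (0ℚ ≤_) (sym (cube-∣∣ z)) (0≤* (ℚP.0≤∣p∣ z) (0≤x*x z))

  weighted-cube-∣∣ : ∀ {B : Set} (ρ x : B → ℚ) p → ∣ ρ p ∣ * cube ∣ x p ∣ ≡ ∣ ρ p ∣ * ∣ x p ∣ * (x p * x p)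
  weighted-cube-∣∣ ρ x p = trans (cong (∣ ρ p ∣ *_) (cube-∣∣ (x p))) (sym (ℚP.*-assoc (∣ ρ p ∣) (∣ x p ∣) _))

  0≤weighted-cube-∣∣ : ∀ {B : Set} (ρ x : B → ℚ) p → 0ℚ ≤ ∣ ρ p ∣ * cube ∣ x p ∣
  0≤weighted-cube-∣∣ ρ x p = 0≤* (ℚP.0≤∣p∣ (ρ p)) (0≤cube-∣∣ (x p))

  X² : Path → ℚ
  X² p = fromℤ (X p) * fromℤ (X p)

  moment-bound : ∀ m → E (suc m) (λ p → ∣ fromℤ (X p) ∣ * ∣ fromℤ (X p) ∣) * 1ℚ * E (suc m) (λ p → X² p * X² p)
                       ≡ fromℕ m * fromℕ m * fromℕ (2 ℕ.* suc m ℕ.∸ 3)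
  moment-bound m = begin
    E (suc m) (λ p → ∣ fromℤ (X p) ∣ * ∣ fromℤ (X p) ∣) * 1ℚ * E (suc m) (λ p → X² p * X² p)
      ≡⟨ cong₂ (λ e f → e * 1ℚ * f) (trans (E-cong (suc m) (∣x∣*∣x∣ ∘ fromℤ ∘ X)) (square-moment m)) (fourth-moment m) ⟩
    fromℕ m * 1ℚ * (fromℕ m * fromℕ (2 ℕ.* suc m ℕ.∸ 3))
      ≡⟨ regroup (fromℕ m) _ ⟩
    fromℕ m * fromℕ m * fromℕ (2 ℕ.* suc m ℕ.∸ 3) ∎
    where
    open ≡-Reasoning
    regroup : ∀ a d → a * 1ℚ * (a * d) ≡ a * a * d
    regroup = solveℚ-∀ ringℚ

  mixed-bound : ∀ k → let m = suc (suc k) in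
    E (suc m) (λ p → ∣ normChar p ∣ * ∣ fromℤ (X p) ∣ * (∣ normChar p ∣ * ∣ fromℤ (X p) ∣)) * fromℕ (choose2 m)
      * E (suc m) (λ p → X² p * X² p)
    ≡ fromℕ m * fromℕ m * fromℕ (2 ℕ.* suc m ℕ.∸ 3)
  mixed-bound k = begin
    E (suc m) (λ p → ∣ normChar p ∣ * ∣ fromℤ (X p) ∣ * (∣ normChar p ∣ * ∣ fromℤ (X p) ∣)) * fromℕ (choose2 m)
      * E (suc m) (λ p → X² p * X² p)
      ≡⟨ cong₂ (λ e f → e * fromℕ (choose2 m) * f) (E-cong (suc m) squares) (fourth-moment m) ⟩
    E (suc m) (λ p → (normChar p * normChar p) * X² p) * fromℕ (choose2 m) * (fromℕ m * fromℕ (2 ℕ.* suc m ℕ.∸ 3))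
      ≡⟨ cong (_* (fromℕ m * fromℕ (2 ℕ.* suc m ℕ.∸ 3))) (mixed-moment k) ⟩
    fromℕ m * (fromℕ m * fromℕ (2 ℕ.* suc m ℕ.∸ 3))
      ≡⟨ ℚP.*-assoc (fromℕ m) _ _ ⟨
    fromℕ m * fromℕ m * fromℕ (2 ℕ.* suc m ℕ.∸ 3) ∎
    where
    open ≡-Reasoning
    m = suc (suc k)
    regroup : ∀ a b → a * b * (a * b) ≡ a * a * (b * b)
    regroup = solveℚ-∀ ringℚ
    squares : ∀ p → ∣ normChar p ∣ * ∣ fromℤ (X p) ∣ * (∣ normChar p ∣ * ∣ fromℤ (X p) ∣) ≡ (normChar p * normChar p) * X² p
    squares p = trans (regroup (∣ normChar p ∣) (∣ fromℤ (X p) ∣)) (cong₂ _*_ (∣x∣*∣x∣ (normChar p)) (∣x∣*∣x∣ (fromℤ (X p))))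

open import Data.Nat using (_≤_; _∸_; _*_)
open import Data.Rational using (1ℚ) renaming (_*_ to _*ℚ_)

lemma4 : (n : ℕ) → 3 ≤ n →
    -- (1)  E(|X_n|^3) ≤ (n-1)·√(2n-3)
    LeSqrt (E n (λ p → cube (absℚ (fromℤ (X p))))) 1ℚ
           (fromℕ (n ∸ 1)) (fromℕ (2 * n ∸ 3))
    ×
    -- (2)  E(|T_{n-1}|·|X_n|^3) = √(binom(n-1,2)) · E(|χ/dim|·|X_n|^3) ≤ (n-1)·√(2n-3)
    LeSqrt (E n (λ p → absℚ (normChar p) *ℚ cube (absℚ (fromℤ (X p)))))
           (fromℕ (choose2 (n ∸ 1)))
           (fromℕ (n ∸ 1)) (fromℕ (2 * n ∸ 3))
lemma4 (suc (suc (suc k))) (s≤s (s≤s (s≤s z≤n))) =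
    leSqrt-by-cauchy-schwarz n _ ∣X∣ X² (cube-∣∣ ∘ x) (0≤cube-∣∣ ∘ x) 0≤1ℚ (0≤fromℕ m) (moment-bound m)
  , leSqrt-by-cauchy-schwarz n _ (λ p → ℚ.∣ normChar p ∣ *ℚ ∣X∣ p) X² (weighted-cube-∣∣ normChar x) (0≤weighted-cube-∣∣ normChar x)
      (0≤fromℕ (choose2 m)) (0≤fromℕ m) (mixed-bound k)
  where
  m = suc (suc k)
  n = suc m
  x ∣X∣ : Path → ℚ
  x p = fromℤ (X p)
  ∣X∣ p = ℚ.∣ x p ∣
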